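{- Let $s \geq 0$ and $r>0$ be integers, and let $\alpha$ and $\beta$ be compositions with $|\alpha| = |\beta| + s$. Then \[ \langle \mathfrak{S}_\alpha, F_s \mathfrak{S}_\beta^\ast \rangle = \langle H_{r} \mathfrak{S}_\alpha, \mathfrak{S}_{(s+r,\beta)}^\ast \rangle, \] where $(s+r,\beta)$ denotes the composition $[s+r, \beta_1, \dots, \beta_{\ell(\beta)}]$.
   Context: A composition $\alpha=[\alpha_1,\dots,\alpha_m]$ of $n$ is a tuple of positive integers with sum $|\alpha|=n$; $\ell(\alpha)=m$. $\operatorname{NSym}$ is the free associative algebra over $\mathbb{Q}$ on generators $H_1,H_2,\dots$ ($H_i$ of degree $i$), with $H_0=1$, $H_{ -r}=0$ for $r>0$, $H_\alpha=H_{\alpha_1}\cdots H_{\alpha_m}$. $\operatorname{QSym}$ is the algebra of quasi-symmetric functions, graded dual to $\operatorname{NSym}$ via the pairing $\langle H_\alpha, M_\beta\rangle=\delta_{\alpha,\beta}$ ($M_\beta$ monomial quasi-symmetric functions). $F_\alpha=\sum_{\beta\le\alpha}M_\beta$ (sum over refinements) is the fundamental quasi-symmetric function; $F_s$ is indexed by $[s]$, $F_{1^i}$ by $i$ ones, $F_0=1$. For $F\in\operatorname{QSym}$, $F^\perp$ is the operator on $\operatorname{NSym}$ with $\langle F^\perp H, G\rangle=\langle H,FG\rangle$. $H_m^L$ is left multiplication by $H_m$, and $\mathbb{B}_m=\sum_{i\ge0}(-1)^iH^L_{m+i}F^\perp_{1^i}$ for $m\in\mathbb{Z}$. For $\alpha\in\mathbb{Z}^m$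 the immaculate function is $\mathfrak{S}_\alpha=\mathbb{B}_{\alpha_1}\cdots\mathbb{B}_{\alpha_m}(1)$; $\{\mathfrak{S}_\alpha\}_{\alpha\models n}$ (over compositions) is a basis of the degree-$n$ part of $\operatorname{NSym}$. The dual immaculate functions $\mathfrak{S}^*_\beta\in\operatorname{QSym}$ form the dual basis: $\langle \mathfrak{S}_\alpha,\mathfrak{S}^*_\beta\rangle=\delta_{\alpha,\beta}$ for compositions $\alpha,\beta$. -}

module Defs where

open import Data.Nat as ℕ using (ℕ; zero; suc; _<_; _≤ᵇ_; _∸_)
open import Data.Bool using (Bool; true; false; if_then_else_; _∧_)
open import Data.Maybe using (Maybe; just; nothing)
open import Data.List using (List; []; _∷_; _++_; map; concatMap; foldr; replicate; upTo)
open import Data.Nat.ListAction using (sum)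
open import Data.List.Relation.Unary.All using (All)
open import Data.List.Membership.Propositional using (_∈_)
open import Data.List.Properties using (≡-dec)
open import Data.Product using (_×_; _,_; proj₁; proj₂)
open import Data.Rational using (ℚ; 0ℚ; 1ℚ; _+_; _*_; -_)
open import Relation.Nullary using (yes; no)
open import Relation.Binary.PropositionalEquality using (_≡_)

Comp : Set
Comp = List ℕ

IsComp : Comp → Set
IsComp α = All (λ a → 0 < a) α

-- All compositions of n (each exactly once): every composition of n+1
-- arises from one of n by prepending 1 or incrementing the first part.
comps : ℕ → List Comp
comps zero = [] ∷ []
comps (suc n) = concatMap step (comps n)
  where
  step : Comp → List Comp
  step [] = (1 ∷ []) ∷ []
  step (a ∷ γ) = (1 ∷ a ∷ γ) ∷ (suc a ∷ γ) ∷ []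

compsUpTo : ℕ → List Comp
compsUpTo n = concatMap comps (upTo (suc n))

eqComp : Comp → Comp → Bool
eqComp α β with ≡-dec ℕ._≟_ α β
... | yes _ = true
... | no _ = false

δ : Comp → Comp → ℚ
δ α β = if eqComp α β then 1ℚ else 0ℚ

-- Refinement: (refines β α) iff β ≤ α, i.e. α is obtained from β by
-- adding together consecutive parts.

eat : ℕ → Comp → Maybe Comp
eat zero β = just β
eat (suc a) [] = nothing
eat (suc a) (b ∷ β) = if b ≤ᵇ suc a then eat (suc a ∸ b) β else nothing

refines : Comp → Comp → Bool
refines [] [] = true
refines (_ ∷ _) [] = false
refines β (a ∷ α) with eat a β
... | nothing = false
... | just β' = refines β' α

-- Finite formal ℚ-linear combinations.
-- NSym elements: Σ c H_α ; QSym elements: Σ c M_α (monomial basis).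

LinComb : Set
LinComb = List (ℚ × Comp)

NSym : Set
NSym = LinComb

QSym : Set
QSym = LinComb

scale : ℚ → LinComb → LinComb
scale c = map (λ { (d , α) → (c * d , α) })

sumQ : List ℚ → ℚ
sumQ = foldr _+_ 0ℚ

pair : NSym → QSym → ℚ
pair G F = sumQ (concatMap (λ { (c , α) → map (λ { (d , β) → c * d * δ α β }) F }) G)

-- quasi-shuffle: M_α M_β = Σ_{γ ∈ qsh α β} M_γ
qsh : Comp → Comp → List Comp
qsh [] β = β ∷ []
qsh (a ∷ α) [] = (a ∷ α) ∷ []
qsh (a ∷ α) (b ∷ β) =
  map (a ∷_) (qsh α (b ∷ β)) ++ map (b ∷_) (qsh (a ∷ α) β) ++ map (a ℕ.+ b ∷_) (qsh α β)

qmul : QSym → QSym → QSym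
qmul F G = concatMap (λ { (c , α) → concatMap (λ { (d , β) → map (λ γ → (c * d , γ)) (qsh α β) }) G }) F

M : Comp → QSym
M α = (1ℚ , α) ∷ []

Fund : Comp → QSym
Fund α = concatMap (λ β → if refines β α then M β else []) (comps (sum α))

Fs : ℕ → QSym
Fs zero = Fund []
Fs (suc s) = Fund (suc s ∷ [])

F1 : ℕ → QSym
F1 i = Fund (replicate i 1)

-- F^⊥ , defined by ⟨F^⊥ H, G⟩ = ⟨H, F G⟩:
-- F^⊥ H_α = Σ_β ⟨H_α , F M_β⟩ H_β   (only |β| ≤ |α| can contribute)
perp : QSym → NSym → NSym
perp F G = concatMap (λ { (c , α) →
  map (λ β → (c * pair ((1ℚ , α) ∷ []) (qmul F (M β)) , β)) (compsUpTo (sum α)) }) G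

Hmul : ℕ → NSym → NSym
Hmul zero G = G
Hmul (suc m) G = map (λ { (c , α) → (c , suc m ∷ α) }) G

deg : LinComb → ℕ
deg G = foldr ℕ._⊔_ 0 (map (λ p → sum (proj₂ p)) G)

sign : ℕ → ℚ
sign zero = 1ℚ
sign (suc i) = - sign i

-- 𝔹_m = Σ_{i≥0} (-1)^i H_{m+i} F^⊥_{1^i}; on G the terms with i > deg G vanish
B : ℕ → NSym → NSym
B m G = concatMap (λ i → scale (sign i) (Hmul (m ℕ.+ i) (perp (F1 i) G))) (upTo (suc (deg G)))

one : NSym
one = (1ℚ , []) ∷ []

imm : Comp → NSym
imm α = foldr B one α

-- D is the dual immaculate function 𝔖*_β: homogeneous of degree |β|
-- (supported on compositions of |β|) and ⟨𝔖_γ, D⟩ = δ_{γ,β} for all γ ⊨ |β|.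
IsDualImm : Comp → QSym → Set
IsDualImm β D =
  (∀ {p} → p ∈ D → IsComp (proj₂ p) × sum (proj₂ p) ≡ sum β)
  × (∀ γ → IsComp γ → sum γ ≡ sum β → pair (imm γ) D ≡ δ γ β)

module Submission where

-- The key identity is the expansion H_r G = Σ_s 𝔹_(r+s) F_s^⊥ G for
-- homogeneous G; on coefficients it amounts to Σ_j (-1)^(k-j) h_j e_(k-j) = [k = 0] with h_j = F_j and
-- e_i = F_(1^i), which is checked on monomials by removing first parts of compositions and telescoping.
-- Expanding F_s'^⊥ 𝔖_α in the immaculate basis and using 𝔹_m 𝔖_γ = 𝔖_(m,γ), the summand
-- 𝔹_(r+s') F_s'^⊥ 𝔖_α pairs with 𝔖*_(s+r,β) to the coefficient of 𝔖_β in F_s^⊥ 𝔖_α if s' = s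
-- and to 0 otherwise, and that coefficient is ⟨F_s^⊥ 𝔖_α, 𝔖*_β⟩ = ⟨𝔖_α, F_s 𝔖*_β⟩.

open import Defs
open import Data.Bool using (Bool; true; false; if_then_else_; T)
open import Data.Bool.Properties using (T-≡)
open import Data.Empty using (⊥-elim)
open import Data.List using (List; []; _∷_; _++_; map; concatMap; replicate; upTo; applyUpTo)
open import Data.List.Properties using (≡-dec; map-id; ∷-injectiveˡ; ∷-injectiveʳ; concatMap-++)
open import Data.List.Relation.Unary.All as All using (All; []; _∷_; all?)
import Data.List.Relation.Unary.All.Properties as All
open import Data.Maybe using (just)
open import Data.Nat as ℕ using (ℕ; zero; suc; _∸_; _≤_; _<_; z≤n; s≤s; _≡ᵇ_; _≤ᵇ_)
open import Data.Nat.Induction using (<-rec)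
open import Data.Nat.ListAction using (sum)
import Data.Nat.Properties as ℕ
open import Data.Nat.Solver using () renaming (module +-*-Solver to ℕ-Solver)
open import Data.Product using (_×_; _,_; proj₁; proj₂; map₁; map₂)
open import Data.Rational using (ℚ; 0ℚ; 1ℚ; _+_; _*_; -_)
open import Data.Rational.Properties
open import Data.Rational.Solver using (module +-*-Solver)
open import Function using (_∘_; id)
open import Function.Bundles using (Equivalence)
open import Relation.Binary.Definitions using (tri<; tri≈; tri>)
open import Relation.Binary.PropositionalEquality
open import Relation.Nullary using (yes; no; ¬_; Dec)

open +-*-Solver using (solve; _:=_; _:+_; _:*_; :-_)

private
  variable
    I K : Set

∑ : (I → ℚ) → List I → ℚ
∑ f xs = sumQ (map f xs)

∑-++ : (f : I → ℚ) (xs ys : List I) → ∑ f (xs ++ ys) ≡ ∑ f xs + ∑ f ys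
∑-++ f [] ys = sym (+-identityˡ _)
∑-++ f (x ∷ xs) ys = trans (cong (f x +_) (∑-++ f xs ys)) (sym (+-assoc (f x) _ _))

∑-concatMap : (f : K → ℚ) (g : I → List K) (xs : List I) →
  ∑ f (concatMap g xs) ≡ ∑ (λ x → ∑ f (g x)) xs
∑-concatMap f g [] = refl
∑-concatMap f g (x ∷ xs) =
  trans (∑-++ f (g x) (concatMap g xs)) (cong (∑ f (g x) +_) (∑-concatMap f g xs))

∑-map : (f : K → ℚ) (g : I → K) (xs : List I) → ∑ f (map g xs) ≡ ∑ (f ∘ g) xs
∑-map f g [] = refl
∑-map f g (x ∷ xs) = cong (f (g x) +_) (∑-map f g xs)

∑-cong : {f g : I → ℚ} → (∀ x → f x ≡ g x) → (xs : List I) → ∑ f xs ≡ ∑ g xs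
∑-cong e [] = refl
∑-cong e (x ∷ xs) = cong₂ _+_ (e x) (∑-cong e xs)

∑-congᴬ : {P : I → Set} {f g : I → ℚ} {xs : List I} →
  All P xs → (∀ x → P x → f x ≡ g x) → ∑ f xs ≡ ∑ g xs
∑-congᴬ [] e = refl
∑-congᴬ {xs = x ∷ xs} (p ∷ ps) e = cong₂ _+_ (e x p) (∑-congᴬ ps e)

∑-zero : {f : I → ℚ} → (∀ x → f x ≡ 0ℚ) → (xs : List I) → ∑ f xs ≡ 0ℚ
∑-zero e [] = refl
∑-zero e (x ∷ xs) = trans (cong₂ _+_ (e x) (∑-zero e xs)) (+-identityˡ 0ℚ)

∑-zeroᴬ : {P : I → Set} {f : I → ℚ} {xs : List I} →
  All P xs → (∀ x → P x → f x ≡ 0ℚ) → ∑ f xs ≡ 0ℚ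
∑-zeroᴬ {xs = xs} ps e = trans (∑-congᴬ ps e) (∑-zero (λ _ → refl) xs)

∑-+ : (f g : I → ℚ) (xs : List I) → ∑ (λ x → f x + g x) xs ≡ ∑ f xs + ∑ g xs
∑-+ f g [] = sym (+-identityˡ 0ℚ)
∑-+ f g (x ∷ xs) rewrite ∑-+ f g xs =
  solve 4 (λ a b c d → (a :+ b) :+ (c :+ d) := (a :+ c) :+ (b :+ d)) refl (f x) (g x) (∑ f xs) (∑ g xs)

∑-distribˡ : (c : ℚ) (f : I → ℚ) (xs : List I) → c * ∑ f xs ≡ ∑ (λ x → c * f x) xs
∑-distribˡ c f [] = *-zeroʳ c
∑-distribˡ c f (x ∷ xs) = trans (*-distribˡ-+ c (f x) _) (cong (c * f x +_) (∑-distribˡ c f xs))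

∑-swap : (f : I → K → ℚ) (xs : List I) (ys : List K) →
  ∑ (λ x → ∑ (f x) ys) xs ≡ ∑ (λ y → ∑ (λ x → f x y) xs) ys
∑-swap f [] ys = sym (∑-zero (λ _ → refl) ys)
∑-swap f (x ∷ xs) ys =
  trans (cong (∑ (f x) ys +_) (∑-swap f xs ys)) (sym (∑-+ (f x) (λ y → ∑ (λ x → f x y) xs) ys))

∑ℕ : ℕ → (ℕ → ℚ) → ℚ
∑ℕ zero f = 0ℚ
∑ℕ (suc n) f = f 0 + ∑ℕ n (f ∘ suc)

∑-applyUpTo : (f : ℕ → ℚ) (g : ℕ → ℕ) (n : ℕ) → ∑ f (applyUpTo g n) ≡ ∑ℕ n (f ∘ g)
∑-applyUpTo f g zero = refl
∑-applyUpTo f g (suc n) = cong (f (g 0) +_) (∑-applyUpTo f (g ∘ suc) n)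

∑-upTo : (f : ℕ → ℚ) (n : ℕ) → ∑ f (upTo n) ≡ ∑ℕ n f
∑-upTo f = ∑-applyUpTo f id

∑ℕ-cong : ∀ n {f g : ℕ → ℚ} → (∀ i → i < n → f i ≡ g i) → ∑ℕ n f ≡ ∑ℕ n g
∑ℕ-cong zero e = refl
∑ℕ-cong (suc n) e = cong₂ _+_ (e 0 (s≤s z≤n)) (∑ℕ-cong n (λ i p → e (suc i) (s≤s p)))

∑ℕ-zero : ∀ n {f : ℕ → ℚ} → (∀ i → i < n → f i ≡ 0ℚ) → ∑ℕ n f ≡ 0ℚ
∑ℕ-zero zero e = refl
∑ℕ-zero (suc n) e =
  trans (cong₂ _+_ (e 0 (s≤s z≤n)) (∑ℕ-zero n (λ i p → e (suc i) (s≤s p)))) (+-identityˡ 0ℚ)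

∑ℕ-+ : ∀ n (f g : ℕ → ℚ) → ∑ℕ n (λ i → f i + g i) ≡ ∑ℕ n f + ∑ℕ n g
∑ℕ-+ zero f g = sym (+-identityˡ 0ℚ)
∑ℕ-+ (suc n) f g rewrite ∑ℕ-+ n (f ∘ suc) (g ∘ suc) =
  solve 4 (λ a b c d → (a :+ b) :+ (c :+ d) := (a :+ c) :+ (b :+ d)) refl
    (f 0) (g 0) (∑ℕ n (f ∘ suc)) (∑ℕ n (g ∘ suc))

∑ℕ-distribˡ : ∀ n (c : ℚ) (f : ℕ → ℚ) → c * ∑ℕ n f ≡ ∑ℕ n (λ i → c * f i)
∑ℕ-distribˡ zero c f = *-zeroʳ c
∑ℕ-distribˡ (suc n) c f =
  trans (*-distribˡ-+ c (f 0) _) (cong (c * f 0 +_) (∑ℕ-distribˡ n c (f ∘ suc)))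

∑ℕ-neg : ∀ n (f : ℕ → ℚ) → ∑ℕ n (λ i → - f i) ≡ - ∑ℕ n f
∑ℕ-neg zero f = refl
∑ℕ-neg (suc n) f = trans (cong (- f 0 +_) (∑ℕ-neg n (f ∘ suc))) (sym (neg-distrib-+ (f 0) _))

∑ℕ-last : ∀ n (f : ℕ → ℚ) → ∑ℕ (suc n) f ≡ ∑ℕ n f + f n
∑ℕ-last zero f = trans (+-identityʳ (f 0)) (sym (+-identityˡ (f 0)))
∑ℕ-last (suc n) f = trans (cong (f 0 +_) (∑ℕ-last n (f ∘ suc))) (sym (+-assoc (f 0) _ _))

∑ℕ-∑ : ∀ n (f : ℕ → I → ℚ) (xs : List I) →
  ∑ℕ n (λ i → ∑ (f i) xs) ≡ ∑ (λ x → ∑ℕ n (λ i → f i x)) xs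
∑ℕ-∑ zero f xs = sym (∑-zero (λ _ → refl) xs)
∑ℕ-∑ (suc n) f xs = trans (cong (∑ (f 0) xs +_) (∑ℕ-∑ n (f ∘ suc) xs)) (sym (∑-+ (f 0) _ xs))

∑ℕ-swap : ∀ n m (f : ℕ → ℕ → ℚ) →
  ∑ℕ n (λ i → ∑ℕ m (f i)) ≡ ∑ℕ m (λ j → ∑ℕ n (λ i → f i j))
∑ℕ-swap zero m f = sym (∑ℕ-zero m (λ _ _ → refl))
∑ℕ-swap (suc n) m f = trans (cong (∑ℕ m (f 0) +_) (∑ℕ-swap n m (f ∘ suc))) (sym (∑ℕ-+ m (f 0) _))

∑ℕ-telescope : ∀ n (u v : ℕ → ℚ) → (∀ i → i < n → v i ≡ - u (suc i)) → v n ≡ 0ℚ →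
  ∑ℕ (suc n) (λ i → u i + v i) ≡ u 0
∑ℕ-telescope zero u v e z = trans (+-identityʳ _) (trans (cong (u 0 +_) z) (+-identityʳ (u 0)))
∑ℕ-telescope (suc n) u v e z = begin
    (u 0 + v 0) + ∑ℕ (suc n) (λ i → u (suc i) + v (suc i))
      ≡⟨ cong₂ (λ a b → (u 0 + a) + b) (e 0 (s≤s z≤n))
           (∑ℕ-telescope n (u ∘ suc) (v ∘ suc) (λ i p → e (suc i) (s≤s p)) z) ⟩
    (u 0 + - u 1) + u 1
      ≡⟨ solve 2 (λ a b → (a :+ :- b) :+ b := a) refl (u 0) (u 1) ⟩
    u 0 ∎
  where open ≡-Reasoning

𝟙 : Bool → ℚ
𝟙 true = 1ℚ
𝟙 false = 0ℚ

𝟙-T : ∀ {b} → T b → 𝟙 b ≡ 1ℚ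
𝟙-T {true} _ = refl

𝟙-¬T : ∀ {b} → ¬ T b → 𝟙 b ≡ 0ℚ
𝟙-¬T {true} ¬t = ⊥-elim (¬t _)
𝟙-¬T {false} _ = refl

𝟙-≤ : ∀ {m n} → m ≤ n → 𝟙 (m ≤ᵇ n) ≡ 1ℚ
𝟙-≤ = 𝟙-T ∘ ℕ.≤⇒≤ᵇ

𝟙-≰ : ∀ {m n} → ¬ m ≤ n → 𝟙 (m ≤ᵇ n) ≡ 0ℚ
𝟙-≰ {m} {n} m≰n = 𝟙-¬T (m≰n ∘ ℕ.≤ᵇ⇒≤ m n)

≤ᵇ-suc : ∀ m n → (suc m ≤ᵇ suc n) ≡ (m ≤ᵇ n)
≤ᵇ-suc zero n = refl
≤ᵇ-suc (suc m) n = refl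

≤ᵇ-+ˡ : ∀ r m n → (r ℕ.+ m ≤ᵇ r ℕ.+ n) ≡ (m ≤ᵇ n)
≤ᵇ-+ˡ zero m n = refl
≤ᵇ-+ˡ (suc r) m n = trans (≤ᵇ-suc (r ℕ.+ m) (r ℕ.+ n)) (≤ᵇ-+ˡ r m n)

∑ℕ-from : ∀ k x (G : ℕ → ℚ) →
  ∑ℕ (suc k) (λ j → 𝟙 (x ≤ᵇ j) * G j) ≡ 𝟙 (x ≤ᵇ k) * ∑ℕ (suc (k ∸ x)) (λ j′ → G (x ℕ.+ j′))
∑ℕ-from k zero G = trans (∑ℕ-cong (suc k) (λ j _ → *-identityˡ (G j))) (sym (*-identityˡ _))
∑ℕ-from zero (suc x) G = trans (cong (_+ 0ℚ) (*-zeroˡ (G 0)))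
  (trans (+-identityʳ 0ℚ) (sym (*-zeroˡ (∑ℕ 1 (λ j′ → G (suc x ℕ.+ j′))))))
∑ℕ-from (suc k) (suc x) G = begin
    𝟙 (suc x ≤ᵇ 0) * G 0 + ∑ℕ (suc k) (λ j → 𝟙 (suc x ≤ᵇ suc j) * G (suc j))
      ≡⟨ cong₂ _+_ (*-zeroˡ (G 0)) (∑ℕ-cong (suc k) (λ j _ → cong (λ b → 𝟙 b * G (suc j)) (≤ᵇ-suc x j))) ⟩
    0ℚ + ∑ℕ (suc k) (λ j → 𝟙 (x ≤ᵇ j) * G (suc j))
      ≡⟨ trans (+-identityˡ _) (∑ℕ-from k x (G ∘ suc)) ⟩
    𝟙 (x ≤ᵇ k) * S
      ≡⟨ cong (λ b → 𝟙 b * S) (sym (≤ᵇ-suc x k)) ⟩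
    𝟙 (suc x ≤ᵇ suc k) * S ∎
  where
  open ≡-Reasoning
  S = ∑ℕ (suc (k ∸ x)) (λ j′ → G (suc x ℕ.+ j′))

∑ℕ-𝟙≤-comm : ∀ n k (Y : ℕ → ℚ) →
  ∑ℕ (suc n) (λ s → 𝟙 (s ≤ᵇ k) * Y s) ≡ ∑ℕ (suc k) (λ s → 𝟙 (s ≤ᵇ n) * Y s)
∑ℕ-𝟙≤-comm zero zero Y = refl
∑ℕ-𝟙≤-comm zero (suc k) Y =
  cong (1ℚ * Y 0 +_) (trans (+-identityʳ 0ℚ) (sym (∑ℕ-zero (suc k) (λ s _ → *-zeroˡ (Y (suc s))))))
∑ℕ-𝟙≤-comm (suc n) zero Y =
  cong (1ℚ * Y 0 +_) (trans (∑ℕ-zero (suc n) (λ s _ → *-zeroˡ (Y (suc s)))) (sym (+-identityʳ 0ℚ)))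
∑ℕ-𝟙≤-comm (suc n) (suc k) Y = cong (1ℚ * Y 0 +_) (begin
    ∑ℕ (suc n) (λ s → 𝟙 (suc s ≤ᵇ suc k) * Y (suc s))
      ≡⟨ ∑ℕ-cong (suc n) (λ s _ → cong (λ b → 𝟙 b * Y (suc s)) (≤ᵇ-suc s k)) ⟩
    ∑ℕ (suc n) (λ s → 𝟙 (s ≤ᵇ k) * Y (suc s))
      ≡⟨ ∑ℕ-𝟙≤-comm n k (Y ∘ suc) ⟩
    ∑ℕ (suc k) (λ s → 𝟙 (s ≤ᵇ n) * Y (suc s))
      ≡⟨ ∑ℕ-cong (suc k) (λ s _ → cong (λ b → 𝟙 b * Y (suc s)) (sym (≤ᵇ-suc s n))) ⟩
    ∑ℕ (suc k) (λ s → 𝟙 (suc s ≤ᵇ suc n) * Y (suc s)) ∎)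
  where open ≡-Reasoning

δℕ : ℕ → ℕ → ℚ
δℕ a b = 𝟙 (a ≡ᵇ b)

δℕ-≡ : ∀ {a b} → a ≡ b → δℕ a b ≡ 1ℚ
δℕ-≡ {a} {b} a≡b = 𝟙-T (ℕ.≡⇒≡ᵇ a b a≡b)

δℕ-≢ : ∀ a b → a ≢ b → δℕ a b ≡ 0ℚ
δℕ-≢ a b a≢b = 𝟙-¬T (a≢b ∘ ℕ.≡ᵇ⇒≡ a b)

δℕ-sym : ∀ a b → δℕ a b ≡ δℕ b a
δℕ-sym zero zero = refl
δℕ-sym zero (suc b) = refl
δℕ-sym (suc a) zero = refl
δℕ-sym (suc a) (suc b) = δℕ-sym a b

δℕ-+ˡ : ∀ a b c → a ≤ c → δℕ (a ℕ.+ b) c ≡ δℕ b (c ∸ a)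
δℕ-+ˡ zero b c _ = refl
δℕ-+ˡ (suc a) b (suc c) (s≤s p) = δℕ-+ˡ a b c p

δℕ-suc-+ : ∀ r k → δℕ (suc r) (suc (r ℕ.+ k)) ≡ 𝟙 (k ≡ᵇ 0)
δℕ-suc-+ zero zero = refl
δℕ-suc-+ zero (suc k) = refl
δℕ-suc-+ (suc r) k = δℕ-suc-+ r k

∑ℕ-δℕ : ∀ n {a} (f : ℕ → ℚ) → a < n → ∑ℕ n (λ i → δℕ a i * f i) ≡ f a
∑ℕ-δℕ (suc n) {zero} f _ =
  trans (cong₂ _+_ (*-identityˡ (f 0)) (∑ℕ-zero n (λ i _ → *-zeroˡ (f (suc i))))) (+-identityʳ _)
∑ℕ-δℕ (suc n) {suc a} f (s≤s a<n) =
  trans (cong₂ _+_ (*-zeroˡ (f 0)) (∑ℕ-δℕ n (f ∘ suc) a<n)) (+-identityˡ _)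

∑ℕ-δℕ-out : ∀ n {a} (f : ℕ → ℚ) → n ≤ a → ∑ℕ n (λ i → δℕ a i * f i) ≡ 0ℚ
∑ℕ-δℕ-out n {a} f n≤a = ∑ℕ-zero n (λ i i<n → trans
  (cong (_* f i) (δℕ-≢ a i (λ { refl → ℕ.<-irrefl refl (ℕ.<-≤-trans i<n n≤a) }))) (*-zeroˡ (f i)))

eqComp-refl : ∀ α → eqComp α α ≡ true
eqComp-refl α with ≡-dec (λ m n → m ℕ.≟ n) α α
... | yes _ = refl
... | no α≢α = ⊥-elim (α≢α refl)

eqComp-≢ : ∀ {α β} → α ≢ β → eqComp α β ≡ false
eqComp-≢ {α} {β} α≢β with ≡-dec (λ m n → m ℕ.≟ n) α β
... | yes α≡β = ⊥-elim (α≢β α≡β)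
... | no _ = refl

δ-refl : ∀ α → δ α α ≡ 1ℚ
δ-refl α rewrite eqComp-refl α = refl

δ-≢ : ∀ α β → α ≢ β → δ α β ≡ 0ℚ
δ-≢ α β α≢β rewrite eqComp-≢ α≢β = refl

δ-sym : ∀ α β → δ α β ≡ δ β α
δ-sym α β = byCases (≡-dec ℕ._≟_ α β)
  where
  byCases : Dec (α ≡ β) → δ α β ≡ δ β α
  byCases (yes refl) = refl
  byCases (no α≢β) = trans (δ-≢ α β α≢β) (sym (δ-≢ β α (α≢β ∘ sym)))

δ-[]-∷ : ∀ b β → δ [] (b ∷ β) ≡ 0ℚ
δ-[]-∷ b β = δ-≢ [] (b ∷ β) (λ ())

δ-∷-[] : ∀ b β → δ (b ∷ β) [] ≡ 0ℚ
δ-∷-[] b β = δ-≢ (b ∷ β) [] (λ ())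

δ-∷ : ∀ a b α β → δ (a ∷ α) (b ∷ β) ≡ δℕ a b * δ α β
δ-∷ a b α β = byCases (a ℕ.≟ b) (≡-dec ℕ._≟_ α β)
  where
  byCases : Dec (a ≡ b) → Dec (α ≡ β) → δ (a ∷ α) (b ∷ β) ≡ δℕ a b * δ α β
  byCases (yes refl) (yes refl) =
    trans (δ-refl _) (sym (trans (cong₂ _*_ (δℕ-≡ {a} refl) (δ-refl α)) (*-identityˡ 1ℚ)))
  byCases (yes refl) (no α≢β) =
    trans (δ-≢ _ _ (α≢β ∘ ∷-injectiveʳ))
      (sym (trans (cong (δℕ a a *_) (δ-≢ α β α≢β)) (*-zeroʳ (δℕ a a))))
  byCases (no a≢b) _ =
    trans (δ-≢ _ _ (a≢b ∘ ∷-injectiveˡ))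
      (sym (trans (cong (_* δ α β) (δℕ-≢ a b a≢b)) (*-zeroˡ (δ α β))))

infix 4 _⊨_
_⊨_ : Comp → ℕ → Set
α ⊨ n = IsComp α × sum α ≡ n

comps-⊨ : ∀ n → All (_⊨ n) (comps n)
comps-⊨ zero = ([] , refl) ∷ []
comps-⊨ (suc n) = All.concat⁺ (All.map⁺ (All.map grow (comps-⊨ n)))
  where
  grow : ∀ {β} → β ⊨ n → All (_⊨ suc n) _
  grow {[]} (_ , e) = ((s≤s z≤n ∷ []) , cong suc e) ∷ []
  grow {a ∷ β} (pa ∷ pβ , e) =
    ((s≤s z≤n ∷ pa ∷ pβ) , cong suc e) ∷ ((s≤s z≤n ∷ pβ) , cong suc e) ∷ []

compsUpTo-IsComp : ∀ n → All IsComp (compsUpTo n)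
compsUpTo-IsComp n =
  All.concat⁺ (All.map⁺ (All.applyUpTo⁺₂ id (suc n) (λ m → All.map proj₁ (comps-⊨ m))))

-- peel x β k evaluates k at β with a first part x removed; removing a part 0 leaves β unchanged.
peel : ℕ → Comp → (Comp → ℚ) → ℚ
peel zero β k = k β
peel (suc x) [] k = 0ℚ
peel (suc x) (b ∷ β) k = δℕ b (suc x) * k β

peel-cong : ∀ x β {f g : Comp → ℚ} → (∀ β′ → f β′ ≡ g β′) → peel x β f ≡ peel x β g
peel-cong zero β e = e β
peel-cong (suc x) [] e = refl
peel-cong (suc x) (b ∷ β) e = cong (δℕ b (suc x) *_) (e β)

peel-congᶜ : ∀ x {γ} → IsComp γ → {f g : Comp → ℚ} → (∀ β → IsComp β → f β ≡ g β) →
  peel x γ f ≡ peel x γ g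
peel-congᶜ zero pγ e = e _ pγ
peel-congᶜ (suc x) [] e = refl
peel-congᶜ (suc x) {b ∷ γ} (_ ∷ pγ) e = cong (δℕ b (suc x) *_) (e γ pγ)

peel-zero : ∀ x β → peel x β (λ _ → 0ℚ) ≡ 0ℚ
peel-zero zero β = refl
peel-zero (suc x) [] = refl
peel-zero (suc x) (b ∷ β) = *-zeroʳ (δℕ b (suc x))

peel-+ : ∀ x β (f g : Comp → ℚ) → peel x β (λ b → f b + g b) ≡ peel x β f + peel x β g
peel-+ zero β f g = refl
peel-+ (suc x) [] f g = sym (+-identityˡ 0ℚ)
peel-+ (suc x) (b ∷ β) f g = *-distribˡ-+ (δℕ b (suc x)) (f β) (g β)

peel-* : ∀ x β (c : ℚ) (f : Comp → ℚ) → peel x β (λ b → c * f b) ≡ c * peel x β f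
peel-* zero β c f = refl
peel-* (suc x) [] c f = sym (*-zeroʳ c)
peel-* (suc x) (b ∷ β) c f =
  solve 3 (λ a b c → a :* (b :* c) := b :* (a :* c)) refl (δℕ b (suc x)) c (f β)

peel-∑ : ∀ x β (f : I → Comp → ℚ) (xs : List I) →
  peel x β (λ b → ∑ (λ a → f a b) xs) ≡ ∑ (λ a → peel x β (f a)) xs
peel-∑ x β f [] = peel-zero x β
peel-∑ x β f (a ∷ xs) = trans (peel-+ x β (f a) _) (cong (peel x β (f a) +_) (peel-∑ x β f xs))

peel-∑ℕ : ∀ n x β (f : ℕ → Comp → ℚ) →
  peel x β (λ b → ∑ℕ n (λ i → f i b)) ≡ ∑ℕ n (λ i → peel x β (f i))
peel-∑ℕ zero x β f = peel-zero x β
peel-∑ℕ (suc n) x β f = trans (peel-+ x β (f 0) _) (cong (peel x β (f 0) +_) (peel-∑ℕ n x β (f ∘ suc)))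

*-peel : ∀ (g : Comp → ℚ) c β (k : Comp → ℚ) →
  g β * peel (suc c) β k ≡ peel (suc c) β (λ β′ → g (suc c ∷ β′) * k β′)
*-peel g c [] k = *-zeroʳ (g [])
*-peel g c (b ∷ β) k with b ℕ.≟ suc c
... | yes refl = solve 3 (λ a b c → a :* (b :* c) := b :* (a :* c)) refl (g (b ∷ β)) (δℕ b b) (k β)
... | no b≢c = begin
    g (b ∷ β) * (δℕ b (suc c) * k β)      ≡⟨ cong (λ t → g (b ∷ β) * (t * k β)) (δℕ-≢ b (suc c) b≢c) ⟩
    g (b ∷ β) * (0ℚ * k β)                ≡⟨ trans (cong (g (b ∷ β) *_) (*-zeroˡ (k β))) (*-zeroʳ (g (b ∷ β))) ⟩
    0ℚ                                    ≡⟨ sym (*-zeroˡ (g (suc c ∷ β) * k β)) ⟩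
    0ℚ * (g (suc c ∷ β) * k β)            ≡⟨ cong (_* (g (suc c ∷ β) * k β)) (sym (δℕ-≢ b (suc c) b≢c)) ⟩
    δℕ b (suc c) * (g (suc c ∷ β) * k β)  ∎
  where open ≡-Reasoning

δ-peel : ∀ c α β → δ (suc c ∷ α) β ≡ peel (suc c) β (δ α)
δ-peel c α [] = δ-∷-[] (suc c) α
δ-peel c α (b ∷ β) = trans (δ-∷ (suc c) b α β) (cong (_* δ α β) (δℕ-sym (suc c) b))

peel-δ : ∀ c γ β → δ β (suc c ∷ γ) ≡ peel (suc c) β (λ β′ → δ β′ γ)
peel-δ c γ [] = δ-[]-∷ (suc c) γ
peel-δ c γ (b ∷ β) = δ-∷ b (suc c) β γ

bumped : (Comp → ℚ) → Comp → ℚ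
bumped f [] = 0ℚ
bumped f (a ∷ β) = f (suc a ∷ β)

∑-comps-suc : ∀ n (f : Comp → ℚ) →
  ∑ f (comps (suc n)) ≡ ∑ (λ β → f (1 ∷ β) + bumped f β) (comps n)
∑-comps-suc n f = trans (∑-concatMap f _ (comps n)) (∑-cong split (comps n))
  where
  split : ∀ β → _ ≡ f (1 ∷ β) + bumped f β
  split [] = refl
  split (a ∷ β) = cong (f (1 ∷ a ∷ β) +_) (+-identityʳ (f (suc a ∷ β)))

∑-comps-peel : ∀ x n (f : Comp → ℚ) →
  ∑ (λ β → peel x β f) (comps n) ≡ 𝟙 (x ≤ᵇ n) * ∑ f (comps (n ∸ x))
∑-comps-peel zero n f = sym (*-identityˡ _)
∑-comps-peel (suc x) zero f = trans (+-identityʳ 0ℚ) (sym (*-zeroˡ (∑ f (comps 0))))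
∑-comps-peel (suc zero) (suc n) f =
  trans (∑-comps-suc n (λ β → peel 1 β f)) (trans (∑-congᴬ (comps-⊨ n) onlyOnes) (sym (*-identityˡ _)))
  where
  onlyOnes : ∀ β → β ⊨ n → peel 1 (1 ∷ β) f + bumped (λ β → peel 1 β f) β ≡ f β
  onlyOnes [] _ = trans (+-identityʳ (1ℚ * f [])) (*-identityˡ (f []))
  onlyOnes (suc b ∷ β) _ =
    trans (cong₂ _+_ (*-identityˡ (f (suc b ∷ β))) (*-zeroˡ (f β))) (+-identityʳ (f (suc b ∷ β)))
  onlyOnes (zero ∷ β) ((() ∷ _) , _)
∑-comps-peel (suc (suc x)) (suc n) f =
  trans (∑-comps-suc n (λ β → peel (suc (suc x)) β f)) (trans (∑-cong shorter (comps n)) (∑-comps-peel (suc x) n f))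
  where
  shorter : ∀ β → peel (suc (suc x)) (1 ∷ β) f + bumped (λ β → peel (suc (suc x)) β f) β ≡ peel (suc x) β f
  shorter [] = trans (+-identityʳ _) (*-zeroˡ (f []))
  shorter (b ∷ β) = trans (cong (_+ (δℕ b (suc x) * f β)) (*-zeroˡ (f (b ∷ β)))) (+-identityˡ _)

∑-comps-δ : ∀ γ {n} (g : Comp → ℚ) → γ ⊨ n → ∑ (λ β → g β * δ β γ) (comps n) ≡ g γ
∑-comps-δ [] g (_ , refl) = trans (+-identityʳ _) (trans (cong (g [] *_) (δ-refl [])) (*-identityʳ _))
∑-comps-δ (zero ∷ γ) g ((() ∷ _) , _)
∑-comps-δ (suc c ∷ γ) g ((_ ∷ pγ) , refl) = begin
    ∑ (λ β → g β * δ β (suc c ∷ γ)) (comps n)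
      ≡⟨ ∑-cong (λ β → trans (cong (g β *_) (peel-δ c γ β)) (*-peel g c β _)) (comps n) ⟩
    ∑ (λ β → peel (suc c) β g′) (comps n)
      ≡⟨ ∑-comps-peel (suc c) n g′ ⟩
    𝟙 (suc c ≤ᵇ n) * ∑ g′ (comps (n ∸ suc c))
      ≡⟨ cong₂ (λ u v → u * ∑ g′ (comps v)) (𝟙-≤ (ℕ.m≤m+n (suc c) (sum γ))) (ℕ.m+n∸m≡n (suc c) (sum γ)) ⟩
    1ℚ * ∑ g′ (comps (sum γ))
      ≡⟨ trans (*-identityˡ _) (∑-comps-δ γ (λ β → g (suc c ∷ β)) (pγ , refl)) ⟩
    g (suc c ∷ γ) ∎
  where
  open ≡-Reasoning
  n = suc c ℕ.+ sum γ
  g′ : Comp → ℚ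
  g′ β = g (suc c ∷ β) * δ β γ

∑-comps-δ-out : ∀ γ n (g : Comp → ℚ) → ¬ γ ⊨ n → ∑ (λ β → g β * δ β γ) (comps n) ≡ 0ℚ
∑-comps-δ-out γ n g γ⊭n =
  ∑-zeroᴬ (comps-⊨ n) (λ β β⊨n → trans (cong (g β *_) (δ-≢ β γ (λ { refl → γ⊭n β⊨n }))) (*-zeroʳ (g β)))

∑-compsUpTo-δ : ∀ γ n (g : Comp → ℚ) → IsComp γ →
  ∑ (λ β → g β * δ β γ) (compsUpTo n) ≡ 𝟙 (sum γ ≤ᵇ n) * g γ
∑-compsUpTo-δ γ n g pγ = begin
    ∑ (λ β → g β * δ β γ) (compsUpTo n)
      ≡⟨ ∑-concatMap (λ β → g β * δ β γ) comps (upTo (suc n)) ⟩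
    ∑ (λ m → ∑ (λ β → g β * δ β γ) (comps m)) (upTo (suc n))
      ≡⟨ ∑-cong atSize (upTo (suc n)) ⟩
    ∑ (λ m → δℕ (sum γ) m * g γ) (upTo (suc n))
      ≡⟨ ∑-upTo (λ m → δℕ (sum γ) m * g γ) (suc n) ⟩
    ∑ℕ (suc n) (λ m → δℕ (sum γ) m * g γ)
      ≡⟨ inRange (sum γ ℕ.≤? n) ⟩
    𝟙 (sum γ ≤ᵇ n) * g γ ∎
  where
  open ≡-Reasoning
  atSize : ∀ m → ∑ (λ β → g β * δ β γ) (comps m) ≡ δℕ (sum γ) m * g γ
  atSize m with sum γ ℕ.≟ m
  ... | yes e = trans (∑-comps-δ γ g (pγ , e)) (sym (trans (cong (_* g γ) (δℕ-≡ e)) (*-identityˡ (g γ))))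
  ... | no ne = trans (∑-comps-δ-out γ m g (ne ∘ proj₂))
    (sym (trans (cong (_* g γ) (δℕ-≢ (sum γ) m ne)) (*-zeroˡ (g γ))))
  inRange : Dec (sum γ ≤ n) → ∑ℕ (suc n) (λ m → δℕ (sum γ) m * g γ) ≡ 𝟙 (sum γ ≤ᵇ n) * g γ
  inRange (yes le) = trans (∑ℕ-δℕ (suc n) (λ _ → g γ) (s≤s le))
    (sym (trans (cong (_* g γ) (𝟙-≤ le)) (*-identityˡ _)))
  inRange (no nle) = trans (∑ℕ-δℕ-out (suc n) (λ _ → g γ) (ℕ.≰⇒> nle))
    (sym (trans (cong (_* g γ) (𝟙-≰ nle)) (*-zeroˡ (g γ))))

coeff : LinComb → Comp → ℚ
coeff G γ = ∑ (λ p → proj₁ p * δ (proj₂ p) γ) G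

-- A composition may be listed several times in a linear combination, so equality is coefficient-wise.
record _≈_ (G G′ : LinComb) : Set where
  constructor coeffwise
  field coeff≡ : ∀ γ → coeff G γ ≡ coeff G′ γ
open _≈_

≈-trans : ∀ {G G′ G″} → G ≈ G′ → G′ ≈ G″ → G ≈ G″
≈-trans e f = coeffwise (λ γ → trans (coeff≡ e γ) (coeff≡ f γ))

H : Comp → NSym
H α = (1ℚ , α) ∷ []

coeff-++ : ∀ G G′ γ → coeff (G ++ G′) γ ≡ coeff G γ + coeff G′ γ
coeff-++ G G′ γ = ∑-++ _ G G′

coeff-concatMap : (f : I → LinComb) (xs : List I) → ∀ γ → coeff (concatMap f xs) γ ≡ ∑ (λ x → coeff (f x) γ) xs
coeff-concatMap f xs γ = ∑-concatMap _ f xs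

coeff-scale : ∀ c G γ → coeff (scale c G) γ ≡ c * coeff G γ
coeff-scale c G γ =
  trans (∑-map _ _ G) (trans (∑-cong (λ p → *-assoc c (proj₁ p) _) G) (sym (∑-distribˡ c _ G)))

coeff-H : ∀ α γ → coeff (H α) γ ≡ δ α γ
coeff-H α γ = trans (+-identityʳ _) (*-identityˡ _)

pair-∑ : ∀ G D → pair G D ≡ ∑ (λ p → ∑ (λ q → proj₁ p * proj₁ q * δ (proj₂ p) (proj₂ q)) D) G
pair-∑ G D =
  trans (cong sumQ (sym (map-id (concatMap row G))))
    (trans (∑-concatMap id row G) (∑-cong (λ p → ∑-map id (entry p) D) G))
  where
  entry : ℚ × Comp → ℚ × Comp → ℚ
  entry p q = proj₁ p * proj₁ q * δ (proj₂ p) (proj₂ q)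
  row : ℚ × Comp → List ℚ
  row p = map (entry p) D

pair-coeff : ∀ G D → pair G D ≡ ∑ (λ q → proj₁ q * coeff G (proj₂ q)) D
pair-coeff G D = begin
    pair G D
      ≡⟨ pair-∑ G D ⟩
    ∑ (λ p → ∑ (λ q → proj₁ p * proj₁ q * δ (proj₂ p) (proj₂ q)) D) G
      ≡⟨ ∑-swap _ G D ⟩
    ∑ (λ q → ∑ (λ p → proj₁ p * proj₁ q * δ (proj₂ p) (proj₂ q)) G) D
      ≡⟨ ∑-cong (λ q → trans (∑-cong (λ p → reorder (proj₁ p) (proj₁ q) _) G) (sym (∑-distribˡ (proj₁ q) _ G))) D ⟩
    ∑ (λ q → proj₁ q * coeff G (proj₂ q)) D ∎
  where
  open ≡-Reasoning
  reorder : ∀ a b c → a * b * c ≡ b * (a * c)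
  reorder = solve 3 (λ a b c → a :* b :* c := b :* (a :* c)) refl

pair-≈ : ∀ {G G′} → G ≈ G′ → ∀ D → pair G D ≡ pair G′ D
pair-≈ {G} {G′} e D =
  trans (pair-coeff G D) (trans (∑-cong (λ q → cong (proj₁ q *_) (coeff≡ e (proj₂ q))) D) (sym (pair-coeff G′ D)))

pair-H : ∀ α D → pair (H α) D ≡ ∑ (λ q → proj₁ q * δ α (proj₂ q)) D
pair-H α D = trans (pair-∑ (H α) D)
  (trans (+-identityʳ _) (∑-cong (λ q → cong (_* δ α (proj₂ q)) (*-identityˡ (proj₁ q))) D))

pair-lin : ∀ G D → pair G D ≡ ∑ (λ p → proj₁ p * pair (H (proj₂ p)) D) G
pair-lin G D = trans (pair-∑ G D) (∑-cong (λ p → trans (∑-cong (λ q → *-assoc (proj₁ p) _ _) D)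
  (trans (sym (∑-distribˡ (proj₁ p) _ D)) (cong (proj₁ p *_) (sym (pair-H (proj₂ p) D))))) G)

pair-concatMap : (f : I → NSym) (xs : List I) (D : QSym) → pair (concatMap f xs) D ≡ ∑ (λ x → pair (f x) D) xs
pair-concatMap f xs D =
  trans (pair-lin (concatMap f xs) D) (trans (∑-concatMap _ f xs) (∑-cong (λ x → sym (pair-lin (f x) D)) xs))

pair-scale : ∀ c G D → pair (scale c G) D ≡ c * pair G D
pair-scale c G D = begin
    pair (scale c G) D
      ≡⟨ trans (pair-lin (scale c G) D) (∑-map _ _ G) ⟩
    ∑ (λ p → c * proj₁ p * pair (H (proj₂ p)) D) G
      ≡⟨ trans (∑-cong (λ p → *-assoc c (proj₁ p) _) G) (sym (∑-distribˡ c _ G)) ⟩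
    c * ∑ (λ p → proj₁ p * pair (H (proj₂ p)) D) G
      ≡⟨ cong (c *_) (sym (pair-lin G D)) ⟩
    c * pair G D ∎
  where open ≡-Reasoning

qshSum : (Comp → ℚ) → Comp → Comp → ℚ
qshSum g β γ = ∑ g (qsh β γ)

qshSum-[]ˡ : ∀ g γ → qshSum g [] γ ≡ g γ
qshSum-[]ˡ g γ = +-identityʳ (g γ)

qshSum-[]ʳ : ∀ g β → qshSum g β [] ≡ g β
qshSum-[]ʳ g [] = +-identityʳ (g [])
qshSum-[]ʳ g (b ∷ β) = +-identityʳ (g (b ∷ β))

qshSum-∷ : ∀ g b β c γ → qshSum g (b ∷ β) (c ∷ γ) ≡
  qshSum (g ∘ (b ∷_)) β (c ∷ γ) + (qshSum (g ∘ (c ∷_)) (b ∷ β) γ + qshSum (g ∘ (b ℕ.+ c ∷_)) β γ)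
qshSum-∷ g b β c γ = begin
    ∑ g (bs ++ cs ++ bcs)          ≡⟨ trans (∑-++ g bs (cs ++ bcs)) (cong (∑ g bs +_) (∑-++ g cs bcs)) ⟩
    ∑ g bs + (∑ g cs + ∑ g bcs)    ≡⟨ cong₂ _+_ (∑-map g _ (qsh β (c ∷ γ)))
                                        (cong₂ _+_ (∑-map g _ (qsh (b ∷ β) γ)) (∑-map g _ (qsh β γ))) ⟩
    _ ∎
  where
  open ≡-Reasoning
  bs = map (b ∷_) (qsh β (c ∷ γ))
  cs = map (c ∷_) (qsh (b ∷ β) γ)
  bcs = map (b ℕ.+ c ∷_) (qsh β γ)

qsh-⊨ : ∀ {ε γ} → IsComp ε → IsComp γ → All (_⊨ sum ε ℕ.+ sum γ) (qsh ε γ)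
qsh-⊨ {[]} _ pγ = (pγ , refl) ∷ []
qsh-⊨ {e ∷ ε} {[]} pε _ = (pε , sym (ℕ.+-identityʳ _)) ∷ []
qsh-⊨ {e ∷ ε} {g ∷ γ} (pe ∷ pε) (pg ∷ pγ) =
  All.++⁺ (All.map⁺ (All.map (prepend pe left) (qsh-⊨ pε (pg ∷ pγ))))
    (All.++⁺ (All.map⁺ (All.map (prepend pg middle) (qsh-⊨ (pe ∷ pε) pγ)))
      (All.map⁺ (All.map (prepend (ℕ.<-≤-trans pe (ℕ.m≤m+n e g)) right) (qsh-⊨ pε pγ))))
  where
  open ℕ-Solver using () renaming (solve to solveℕ; _:=_ to _:=ℕ_; _:+_ to _:+ℕ_)
  prepend : ∀ {a m n ζ} → 0 < a → a ℕ.+ m ≡ n → ζ ⊨ m → (a ∷ ζ) ⊨ n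
  prepend pa e (pζ , refl) = (pa ∷ pζ) , e
  left : e ℕ.+ (sum ε ℕ.+ (g ℕ.+ sum γ)) ≡ e ℕ.+ sum ε ℕ.+ (g ℕ.+ sum γ)
  left = sym (ℕ.+-assoc e (sum ε) _)
  middle : g ℕ.+ (e ℕ.+ sum ε ℕ.+ sum γ) ≡ e ℕ.+ sum ε ℕ.+ (g ℕ.+ sum γ)
  middle = solveℕ 4 (λ e ε g γ → g :+ℕ (e :+ℕ ε :+ℕ γ) :=ℕ e :+ℕ ε :+ℕ (g :+ℕ γ)) refl e (sum ε) g (sum γ)
  right : e ℕ.+ g ℕ.+ (sum ε ℕ.+ sum γ) ≡ e ℕ.+ sum ε ℕ.+ (g ℕ.+ sum γ)
  right = solveℕ 4 (λ e ε g γ → e :+ℕ g :+ℕ (ε :+ℕ γ) :=ℕ e :+ℕ ε :+ℕ (g :+ℕ γ)) refl e (sum ε) g (sum γ)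

peel-pos-[] : ∀ x {f} → 0 < x → peel x [] f ≡ 0ℚ
peel-pos-[] (suc x) _ = refl

peel-pos-∷ : ∀ x {b β f} → 0 < x → peel x (b ∷ β) f ≡ δℕ b x * f β
peel-pos-∷ (suc x) _ = refl

∑ℕ-δℕ-peel : ∀ e m g γ (f : Comp → ℚ) →
  ∑ℕ (suc m) (λ z → δℕ e z * peel (m ∸ z) (suc g ∷ γ) f) ≡ δℕ e m * f (suc g ∷ γ) + δℕ (e ℕ.+ suc g) m * f γ
∑ℕ-δℕ-peel e m g γ f with ℕ.<-cmp e m
... | tri< e<m e≢m _ = begin
    ∑ℕ (suc m) (λ z → δℕ e z * peel (m ∸ z) (suc g ∷ γ) f)
      ≡⟨ ∑ℕ-δℕ (suc m) (λ z → peel (m ∸ z) (suc g ∷ γ) f) (ℕ.m<n⇒m<1+n e<m) ⟩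
    peel (m ∸ e) (suc g ∷ γ) f
      ≡⟨ peel-pos-∷ (m ∸ e) (ℕ.m<n⇒0<n∸m e<m) ⟩
    δℕ (suc g) (m ∸ e) * f γ
      ≡⟨ sym (trans (cong (_+ (δℕ (suc g) (m ∸ e) * f γ)) (*-zeroˡ (f (suc g ∷ γ)))) (+-identityˡ _)) ⟩
    0ℚ * f (suc g ∷ γ) + δℕ (suc g) (m ∸ e) * f γ
      ≡⟨ sym (cong₂ (λ a b → a * f (suc g ∷ γ) + b * f γ) (δℕ-≢ e m e≢m) (δℕ-+ˡ e (suc g) m (ℕ.<⇒≤ e<m))) ⟩
    δℕ e m * f (suc g ∷ γ) + δℕ (e ℕ.+ suc g) m * f γ ∎
  where open ≡-Reasoning
... | tri≈ _ refl _ = begin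
    ∑ℕ (suc e) (λ z → δℕ e z * peel (e ∸ z) (suc g ∷ γ) f)
      ≡⟨ ∑ℕ-δℕ (suc e) (λ z → peel (e ∸ z) (suc g ∷ γ) f) (ℕ.n<1+n e) ⟩
    peel (e ∸ e) (suc g ∷ γ) f
      ≡⟨ cong (λ t → peel t (suc g ∷ γ) f) (ℕ.n∸n≡0 e) ⟩
    f (suc g ∷ γ)
      ≡⟨ sym (trans (cong₂ _+_ (*-identityˡ (f (suc g ∷ γ))) (*-zeroˡ (f γ))) (+-identityʳ _)) ⟩
    1ℚ * f (suc g ∷ γ) + 0ℚ * f γ
      ≡⟨ sym (cong₂ (λ a b → a * f (suc g ∷ γ) + b * f γ) (δℕ-≡ {e} refl) (δℕ-≢ (e ℕ.+ suc g) e (ℕ.m+1+n≢m e))) ⟩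
    δℕ e e * f (suc g ∷ γ) + δℕ (e ℕ.+ suc g) e * f γ ∎
  where open ≡-Reasoning
... | tri> _ e≢m m<e = begin
    ∑ℕ (suc m) (λ z → δℕ e z * peel (m ∸ z) (suc g ∷ γ) f)
      ≡⟨ ∑ℕ-δℕ-out (suc m) (λ z → peel (m ∸ z) (suc g ∷ γ) f) m<e ⟩
    0ℚ
      ≡⟨ sym (trans (cong₂ _+_ (*-zeroˡ (f (suc g ∷ γ))) (*-zeroˡ (f γ))) (+-identityʳ 0ℚ)) ⟩
    0ℚ * f (suc g ∷ γ) + 0ℚ * f γ
      ≡⟨ sym (cong₂ (λ a b → a * f (suc g ∷ γ) + b * f γ) (δℕ-≢ e m e≢m)
           (δℕ-≢ (e ℕ.+ suc g) m (λ eq → ℕ.<-irrefl (sym eq) (ℕ.<-≤-trans m<e (ℕ.m≤m+n e (suc g)))))) ⟩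
    δℕ e m * f (suc g ∷ γ) + δℕ (e ℕ.+ suc g) m * f γ ∎
  where open ≡-Reasoning

-- The first part of a quasi-shuffle is the first part of ε, that of γ, or their sum.
qsh-peel : ∀ m (k : Comp → ℚ) {ε γ} → IsComp ε → IsComp γ →
  qshSum (λ ζ → peel m ζ k) ε γ ≡ ∑ℕ (suc m) (λ y → peel y ε (λ ε′ → peel (m ∸ y) γ (qshSum k ε′)))
qsh-peel zero k _ _ = sym (+-identityʳ _)
qsh-peel (suc m) k {[]} {γ} _ _ = begin
    qshSum (λ ζ → peel (suc m) ζ k) [] γ  ≡⟨ qshSum-[]ˡ (λ ζ → peel (suc m) ζ k) γ ⟩
    peel (suc m) γ k                       ≡⟨ peel-cong (suc m) γ (λ γ′ → sym (qshSum-[]ˡ k γ′)) ⟩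
    P                                      ≡⟨ sym (+-identityʳ P) ⟩
    P + 0ℚ                                 ≡⟨ cong (P +_) (sym (∑ℕ-zero (suc m) (λ _ _ → refl))) ⟩
    ∑ℕ (suc (suc m)) (λ y → peel y [] (λ ε′ → peel (suc m ∸ y) γ (qshSum k ε′))) ∎
  where
  open ≡-Reasoning
  P = peel (suc m) γ (qshSum k [])
qsh-peel (suc m) k {e ∷ ε} {[]} _ _ = begin
    qshSum (λ ζ → peel (suc m) ζ k) (e ∷ ε) []      ≡⟨ qshSum-[]ʳ (λ ζ → peel (suc m) ζ k) (e ∷ ε) ⟩
    δℕ e (suc m) * k ε                               ≡⟨ cong (δℕ e (suc m) *_) (sym (trans
                                                          (cong (λ t → peel t [] (qshSum k ε)) (ℕ.n∸n≡0 m))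
                                                          (qshSum-[]ʳ k ε))) ⟩
    term (suc m)                                     ≡⟨ sym (+-identityˡ _) ⟩
    0ℚ + term (suc m)                                ≡⟨ cong (_+ term (suc m)) (sym (∑ℕ-zero (suc m) vanish)) ⟩
    ∑ℕ (suc m) term + term (suc m)                   ≡⟨ sym (∑ℕ-last (suc m) term) ⟩
    ∑ℕ (suc (suc m)) term ∎
  where
  open ≡-Reasoning
  term : ℕ → ℚ
  term y = peel y (e ∷ ε) (λ ε′ → peel (suc m ∸ y) [] (qshSum k ε′))
  vanish : ∀ y → y < suc m → term y ≡ 0ℚ
  vanish zero _ = refl
  vanish (suc y) (s≤s y<m) =
    trans (cong (δℕ e (suc y) *_) (peel-pos-[] (m ∸ y) (ℕ.m<n⇒0<n∸m y<m))) (*-zeroʳ (δℕ e (suc y)))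
qsh-peel (suc m) k {e ∷ ε} {zero ∷ γ} _ (() ∷ _)
qsh-peel (suc m) k {zero ∷ ε} {suc g ∷ γ} (() ∷ _) _
qsh-peel (suc m) k {suc e ∷ ε} {suc g ∷ γ} _ _ = begin
    qshSum (λ ζ → peel (suc m) ζ k) (suc e ∷ ε) (suc g ∷ γ)
      ≡⟨ qshSum-∷ _ (suc e) ε (suc g) γ ⟩
    qshSum (λ ζ → δℕ e m * k ζ) ε (suc g ∷ γ)
      + (qshSum (λ ζ → δℕ g m * k ζ) (suc e ∷ ε) γ + qshSum (λ ζ → δℕ (e ℕ.+ suc g) m * k ζ) ε γ)
      ≡⟨ cong₂ _+_ (sym (∑-distribˡ (δℕ e m) k (qsh ε (suc g ∷ γ))))
           (cong₂ _+_ (sym (∑-distribˡ (δℕ g m) k (qsh (suc e ∷ ε) γ)))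
             (sym (∑-distribˡ (δℕ (e ℕ.+ suc g) m) k (qsh ε γ)))) ⟩
    δℕ e m * Q₁ + (δℕ g m * Q₃ + δℕ (e ℕ.+ suc g) m * Q₂)
      ≡⟨ solve 6 (λ a x b y c z → a :* x :+ (b :* y :+ c :* z) := b :* y :+ (a :* x :+ c :* z)) refl
           (δℕ e m) Q₁ (δℕ g m) Q₃ (δℕ (e ℕ.+ suc g) m) Q₂ ⟩
    δℕ g m * Q₃ + (δℕ e m * Q₁ + δℕ (e ℕ.+ suc g) m * Q₂)
      ≡⟨ cong (δℕ g m * Q₃ +_) (sym (∑ℕ-δℕ-peel e m g γ (qshSum k ε))) ⟩
    δℕ g m * Q₃ + ∑ℕ (suc m) (λ z → δℕ e z * peel (m ∸ z) (suc g ∷ γ) (qshSum k ε)) ∎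
  where
  open ≡-Reasoning
  Q₁ = qshSum k ε (suc g ∷ γ)
  Q₂ = qshSum k ε γ
  Q₃ = qshSum k (suc e ∷ ε) γ

-- The identity Σⱼ (-1)^(k-j) h_j e_(k-j) = [k = 0], read off on monomials

ones : ℕ → Comp
ones i = replicate i 1

ones-comp : ∀ i → IsComp (ones i)
ones-comp zero = []
ones-comp (suc i) = s≤s z≤n ∷ ones-comp i

tripleCoeff : Comp → Comp → Comp → Comp → ℚ
tripleCoeff α β ε γ = ∑ (qshSum (δ α) β) (qsh ε γ)

-- heCoeff α i j γ is the coefficient of M_α in F_j F_(1^i) M_γ, as F_j = Σ_(β ⊨ j) M_β and F_(1^i) = M_(1^i).
heCoeff : Comp → ℕ → ℕ → Comp → ℚ
heCoeff α i j γ = ∑ (λ β → tripleCoeff α β (ones i) γ) (comps j)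

altHeCoeff : Comp → ℕ → Comp → ℚ
altHeCoeff α k γ = ∑ℕ (suc k) (λ j → sign (k ∸ j) * heCoeff α (k ∸ j) j γ)

qshSum-δ[] : ∀ β γ → qshSum (δ []) β γ ≡ δ [] β * δ [] γ
qshSum-δ[] [] γ = trans (qshSum-[]ˡ (δ []) γ) (sym (trans (cong (_* δ [] γ) (δ-refl [])) (*-identityˡ (δ [] γ))))
qshSum-δ[] (b ∷ β) [] =
  trans (qshSum-[]ʳ (δ []) (b ∷ β))
    (trans (δ-[]-∷ b β) (sym (trans (cong (_* δ [] []) (δ-[]-∷ b β)) (*-zeroˡ (δ [] [])))))
qshSum-δ[] (b ∷ β) (c ∷ γ) = begin
    qshSum (δ []) (b ∷ β) (c ∷ γ)
      ≡⟨ qshSum-∷ (δ []) b β c γ ⟩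
    qshSum (δ [] ∘ (b ∷_)) β (c ∷ γ) + (qshSum (δ [] ∘ (c ∷_)) (b ∷ β) γ + qshSum (δ [] ∘ (b ℕ.+ c ∷_)) β γ)
      ≡⟨ cong₂ _+_ (nonEmpty b β (c ∷ γ)) (cong₂ _+_ (nonEmpty c (b ∷ β) γ) (nonEmpty (b ℕ.+ c) β γ)) ⟩
    0ℚ + (0ℚ + 0ℚ)
      ≡⟨ sym (*-zeroˡ (δ [] (c ∷ γ))) ⟩
    0ℚ * δ [] (c ∷ γ)
      ≡⟨ cong (_* δ [] (c ∷ γ)) (sym (δ-[]-∷ b β)) ⟩
    δ [] (b ∷ β) * δ [] (c ∷ γ) ∎
  where
  open ≡-Reasoning
  nonEmpty : ∀ a β γ → qshSum (δ [] ∘ (a ∷_)) β γ ≡ 0ℚ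
  nonEmpty a β γ = ∑-zero (δ-[]-∷ a) (qsh β γ)

tripleCoeff-[] : ∀ β ε γ → tripleCoeff [] β ε γ ≡ δ [] β * (δ [] ε * δ [] γ)
tripleCoeff-[] β ε γ = begin
    ∑ (qshSum (δ []) β) (qsh ε γ)       ≡⟨ ∑-cong (qshSum-δ[] β) (qsh ε γ) ⟩
    ∑ (λ ζ → δ [] β * δ [] ζ) (qsh ε γ) ≡⟨ sym (∑-distribˡ (δ [] β) (δ []) (qsh ε γ)) ⟩
    δ [] β * qshSum (δ []) ε γ          ≡⟨ cong (δ [] β *_) (qshSum-δ[] ε γ) ⟩
    δ [] β * (δ [] ε * δ [] γ)          ∎
  where open ≡-Reasoning

heCoeff-[] : ∀ i j γ → heCoeff [] i j γ ≡ 𝟙 (j ≡ᵇ 0) * (δ [] (ones i) * δ [] γ)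
heCoeff-[] i j γ = trans (∑-cong moveδ (comps j)) (onlyEmpty j)
  where
  c = δ [] (ones i) * δ [] γ
  moveδ : ∀ β → tripleCoeff [] β (ones i) γ ≡ c * δ β []
  moveδ β = trans (tripleCoeff-[] β (ones i) γ) (trans (*-comm (δ [] β) c) (cong (c *_) (δ-sym [] β)))
  onlyEmpty : ∀ j → ∑ (λ β → c * δ β []) (comps j) ≡ 𝟙 (j ≡ᵇ 0) * c
  onlyEmpty zero = trans (∑-comps-δ [] (λ _ → c) ([] , refl)) (sym (*-identityˡ c))
  onlyEmpty (suc j) = trans (∑-comps-δ-out [] (suc j) (λ _ → c) (λ ())) (sym (*-zeroˡ c))

altHeCoeff-[] : ∀ k γ → altHeCoeff [] k γ ≡ 𝟙 (k ≡ᵇ 0) * δ [] γ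
altHeCoeff-[] k γ = begin
    sign k * heCoeff [] k 0 γ + ∑ℕ k (λ j → sign (k ∸ suc j) * heCoeff [] (k ∸ suc j) (suc j) γ)
      ≡⟨ cong₂ _+_ (cong (sign k *_) (trans (heCoeff-[] k 0 γ) (*-identityˡ _))) (∑ℕ-zero k positiveSize) ⟩
    sign k * (δ [] (ones k) * δ [] γ) + 0ℚ
      ≡⟨ trans (+-identityʳ _) (onlyEmpty k) ⟩
    𝟙 (k ≡ᵇ 0) * δ [] γ ∎
  where
  open ≡-Reasoning
  positiveSize : ∀ j → j < k → sign (k ∸ suc j) * heCoeff [] (k ∸ suc j) (suc j) γ ≡ 0ℚ
  positiveSize j _ = trans (cong (sign (k ∸ suc j) *_)
    (trans (heCoeff-[] (k ∸ suc j) (suc j) γ) (*-zeroˡ (δ [] (ones (k ∸ suc j)) * δ [] γ))))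
    (*-zeroʳ (sign (k ∸ suc j)))
  onlyEmpty : ∀ k → sign k * (δ [] (ones k) * δ [] γ) ≡ 𝟙 (k ≡ᵇ 0) * δ [] γ
  onlyEmpty zero = trans (*-identityˡ _) (cong (_* δ [] γ) (δ-refl []))
  onlyEmpty (suc k) = begin
      sign (suc k) * (δ [] (ones (suc k)) * δ [] γ)
        ≡⟨ cong (λ t → sign (suc k) * (t * δ [] γ)) (δ-[]-∷ 1 (ones k)) ⟩
      sign (suc k) * (0ℚ * δ [] γ)
        ≡⟨ trans (cong (sign (suc k) *_) (*-zeroˡ (δ [] γ))) (*-zeroʳ (sign (suc k))) ⟩
      0ℚ
        ≡⟨ sym (*-zeroˡ (δ [] γ)) ⟩
      0ℚ * δ [] γ ∎

tripleCoeff-∷ : ∀ a α {β ε γ} → IsComp β → IsComp ε → IsComp γ →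
  tripleCoeff (suc a ∷ α) β ε γ ≡
    ∑ℕ (suc (suc a)) (λ x → peel x β (λ β′ →
      ∑ℕ (suc (suc a ∸ x)) (λ y → peel y ε (λ ε′ → peel (suc a ∸ x ∸ y) γ (tripleCoeff α β′ ε′)))))
tripleCoeff-∷ a α {β} {ε} {γ} pβ pε pγ = begin
    ∑ (qshSum (δ (suc a ∷ α)) β) (qsh ε γ)
      ≡⟨ ∑-cong (λ ζ → ∑-cong (δ-peel a α) (qsh β ζ)) (qsh ε γ) ⟩
    ∑ (qshSum (λ ζ → peel (suc a) ζ (δ α)) β) (qsh ε γ)
      ≡⟨ ∑-congᴬ (qsh-⊨ pε pγ) (λ ζ ζ⊨ → qsh-peel (suc a) (δ α) pβ (proj₁ ζ⊨)) ⟩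
    ∑ (λ ζ → ∑ℕ (suc (suc a)) (λ x → peel x β (λ β′ → peel (suc a ∸ x) ζ (qshSum (δ α) β′)))) (qsh ε γ)
      ≡⟨ sym (∑ℕ-∑ (suc (suc a)) (λ x ζ → peel x β (λ β′ → peel (suc a ∸ x) ζ (qshSum (δ α) β′))) (qsh ε γ)) ⟩
    ∑ℕ (suc (suc a)) (λ x → ∑ (λ ζ → peel x β (λ β′ → peel (suc a ∸ x) ζ (qshSum (δ α) β′))) (qsh ε γ))
      ≡⟨ ∑ℕ-cong (suc (suc a)) (λ x _ →
           sym (peel-∑ x β (λ ζ β′ → peel (suc a ∸ x) ζ (qshSum (δ α) β′)) (qsh ε γ))) ⟩
    ∑ℕ (suc (suc a)) (λ x → peel x β (λ β′ → qshSum (λ ζ → peel (suc a ∸ x) ζ (qshSum (δ α) β′)) ε γ))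
      ≡⟨ ∑ℕ-cong (suc (suc a)) (λ x _ → peel-cong x β (λ β′ → qsh-peel (suc a ∸ x) (qshSum (δ α) β′) pε pγ)) ⟩
    ∑ℕ (suc (suc a)) (λ x → peel x β (λ β′ →
      ∑ℕ (suc (suc a ∸ x)) (λ y → peel y ε (λ ε′ → peel (suc a ∸ x ∸ y) γ (tripleCoeff α β′ ε′))))) ∎
  where open ≡-Reasoning

atPred : ℕ → (ℕ → ℚ) → ℚ
atPred zero f = 0ℚ
atPred (suc i) f = f i

atPredIfPos : ℕ → ℕ → (ℕ → ℚ) → ℚ
atPredIfPos zero i f = 0ℚ
atPredIfPos (suc _) i f = atPred i f

atPredIfPos-cong : ∀ A i {f g : ℕ → ℚ} → (∀ i′ → f i′ ≡ g i′) → atPredIfPos A i f ≡ atPredIfPos A i g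
atPredIfPos-cong zero i e = refl
atPredIfPos-cong (suc A) zero e = refl
atPredIfPos-cong (suc A) (suc i) e = e i

∑-atPredIfPos : ∀ A i (f : I → ℕ → ℚ) (xs : List I) →
  ∑ (λ x → atPredIfPos A i (f x)) xs ≡ atPredIfPos A i (λ i′ → ∑ (λ x → f x i′) xs)
∑-atPredIfPos zero i f xs = ∑-zero (λ _ → refl) xs
∑-atPredIfPos (suc A) zero f xs = ∑-zero (λ _ → refl) xs
∑-atPredIfPos (suc A) (suc i) f xs = refl

sign-atPred : ∀ i (f : ℕ → ℚ) → sign i * atPred i f ≡ - atPred i (λ i′ → sign i′ * f i′)
sign-atPred zero f = *-zeroʳ 1ℚ
sign-atPred (suc i) f = sym (neg-distribˡ-* (sign i) (f i))

-- Only parts 0 and 1 can be removed from 1^i.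
∑ℕ-peel-ones : ∀ A i (F : ℕ → Comp → ℚ) →
  ∑ℕ (suc A) (λ y → peel y (ones i) (F y)) ≡ F 0 (ones i) + atPredIfPos A i (λ i′ → F 1 (ones i′))
∑ℕ-peel-ones zero i F = refl
∑ℕ-peel-ones (suc A) i F =
  cong (F 0 (ones i) +_) (trans (cong₂ _+_ (partOne i) (∑ℕ-zero A (λ y _ → partAboveOne y i))) (+-identityʳ _))
  where
  partOne : ∀ i → peel 1 (ones i) (F 1) ≡ atPred i (λ i′ → F 1 (ones i′))
  partOne zero = refl
  partOne (suc i) = *-identityˡ _
  partAboveOne : ∀ y i → peel (suc (suc y)) (ones i) (F (suc (suc y))) ≡ 0ℚ
  partAboveOne y zero = refl
  partAboveOne y (suc i) = *-zeroˡ (F (suc (suc y)) (ones i))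

heCoeff-∷ : ∀ a α i j {γ} → IsComp γ →
  heCoeff (suc a ∷ α) i j γ ≡
    ∑ℕ (suc (suc a)) (λ x → 𝟙 (x ≤ᵇ j) *
      (peel (suc a ∸ x) γ (heCoeff α i (j ∸ x))
       + atPredIfPos (suc a ∸ x) i (λ i′ → peel (suc a ∸ x ∸ 1) γ (heCoeff α i′ (j ∸ x)))))
heCoeff-∷ a α i j {γ} pγ = begin
    ∑ (λ β → tripleCoeff (suc a ∷ α) β (ones i) γ) (comps j)
      ≡⟨ ∑-congᴬ (comps-⊨ j) (λ β β⊨j → trans (tripleCoeff-∷ a α (proj₁ β⊨j) (ones-comp i) pγ)
           (∑ℕ-cong (suc (suc a)) (λ x _ → peel-cong x β (λ β′ →
             ∑ℕ-peel-ones (suc a ∸ x) i (λ y ε′ → peel (suc a ∸ x ∸ y) γ (tripleCoeff α β′ ε′)))))) ⟩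
    ∑ (λ β → ∑ℕ (suc (suc a)) (λ x → peel x β (Ψ x))) (comps j)
      ≡⟨ sym (∑ℕ-∑ (suc (suc a)) (λ x β → peel x β (Ψ x)) (comps j)) ⟩
    ∑ℕ (suc (suc a)) (λ x → ∑ (λ β → peel x β (Ψ x)) (comps j))
      ≡⟨ ∑ℕ-cong (suc (suc a)) (λ x _ → trans (∑-comps-peel x j (Ψ x)) (cong (𝟙 (x ≤ᵇ j) *_) (sumOverβ x))) ⟩
    ∑ℕ (suc (suc a)) (λ x → 𝟙 (x ≤ᵇ j) *
      (peel (suc a ∸ x) γ (heCoeff α i (j ∸ x))
       + atPredIfPos (suc a ∸ x) i (λ i′ → peel (suc a ∸ x ∸ 1) γ (heCoeff α i′ (j ∸ x))))) ∎
  where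
  open ≡-Reasoning
  Ψ : ℕ → Comp → ℚ
  Ψ x β′ = peel (suc a ∸ x ∸ 0) γ (tripleCoeff α β′ (ones i))
    + atPredIfPos (suc a ∸ x) i (λ i′ → peel (suc a ∸ x ∸ 1) γ (tripleCoeff α β′ (ones i′)))
  sumOverβ : ∀ x → ∑ (Ψ x) (comps (j ∸ x)) ≡
    peel (suc a ∸ x) γ (heCoeff α i (j ∸ x))
    + atPredIfPos (suc a ∸ x) i (λ i′ → peel (suc a ∸ x ∸ 1) γ (heCoeff α i′ (j ∸ x)))
  sumOverβ x = trans (∑-+ _ _ (comps (j ∸ x))) (cong₂ _+_
    (sym (peel-∑ (suc a ∸ x) γ (λ β′ γ′ → tripleCoeff α β′ (ones i) γ′) (comps (j ∸ x))))
    (trans (∑-atPredIfPos (suc a ∸ x) i (λ β′ i′ → peel (suc a ∸ x ∸ 1) γ (tripleCoeff α β′ (ones i′)))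
              (comps (j ∸ x)))
       (atPredIfPos-cong (suc a ∸ x) i (λ i′ →
         sym (peel-∑ (suc a ∸ x ∸ 1) γ (λ β′ γ′ → tripleCoeff α β′ (ones i′) γ′) (comps (j ∸ x)))))))

∑ℕ-from-atPred : ∀ k x (g : ℕ → ℕ → ℚ) →
  ∑ℕ (suc k) (λ j → 𝟙 (x ≤ᵇ j) * atPred (k ∸ j) (g j))
    ≡ 𝟙 (suc x ≤ᵇ k) * ∑ℕ (suc (k ∸ suc x)) (λ j′ → g (x ℕ.+ j′) (k ∸ suc x ∸ j′))
∑ℕ-from-atPred zero x g = trans (cong (_+ 0ℚ) (*-zeroʳ (𝟙 (x ≤ᵇ 0))))
  (trans (+-identityʳ 0ℚ) (sym (*-zeroˡ (∑ℕ 1 (λ j′ → g (x ℕ.+ j′) (0 ∸ suc x ∸ j′))))))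
∑ℕ-from-atPred (suc k) x g = begin
    ∑ℕ (suc (suc k)) (λ j → 𝟙 (x ≤ᵇ j) * atPred (suc k ∸ j) (g j))
      ≡⟨ ∑ℕ-last (suc k) (λ j → 𝟙 (x ≤ᵇ j) * atPred (suc k ∸ j) (g j)) ⟩
    ∑ℕ (suc k) (λ j → 𝟙 (x ≤ᵇ j) * atPred (suc k ∸ j) (g j)) + 𝟙 (x ≤ᵇ suc k) * atPred (k ∸ k) (g (suc k))
      ≡⟨ cong₂ _+_
           (∑ℕ-cong (suc k) (λ j j<k → cong (λ t → 𝟙 (x ≤ᵇ j) * atPred t (g j)) (ℕ.+-∸-assoc 1 (ℕ.≤-pred j<k))))
           (trans (cong (λ t → 𝟙 (x ≤ᵇ suc k) * atPred t (g (suc k))) (ℕ.n∸n≡0 k)) (*-zeroʳ (𝟙 (x ≤ᵇ suc k)))) ⟩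
    ∑ℕ (suc k) (λ j → 𝟙 (x ≤ᵇ j) * g j (k ∸ j)) + 0ℚ
      ≡⟨ trans (+-identityʳ _) (∑ℕ-from k x (λ j → g j (k ∸ j))) ⟩
    𝟙 (x ≤ᵇ k) * ∑ℕ (suc (k ∸ x)) (λ j′ → g (x ℕ.+ j′) (k ∸ (x ℕ.+ j′)))
      ≡⟨ cong₂ (λ b s → 𝟙 b * s) (sym (≤ᵇ-suc x k))
           (∑ℕ-cong (suc (k ∸ x)) (λ j′ _ → cong (g (x ℕ.+ j′)) (sym (ℕ.∸-+-assoc k x j′)))) ⟩
    𝟙 (suc x ≤ᵇ suc k) * ∑ℕ (suc (suc k ∸ suc x)) (λ j′ → g (x ℕ.+ j′) (suc k ∸ suc x ∸ j′)) ∎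
  where open ≡-Reasoning

-- Removing the first part suc a of α: by heCoeff-∷ the alternating sum splits into terms u x + v x
-- over the size x ≤ suc a of the part taken from h_j, and these telescope since v x = - u (x + 1).
module AltHeCoeff-∷ (a : ℕ) (α : Comp) (k : ℕ) {γ : Comp} (pγ : IsComp γ)
    (hyp : ∀ k′ {γ′} → IsComp γ′ → altHeCoeff α k′ γ′ ≡ 𝟙 (k′ ≡ᵇ 0) * δ α γ′) where

  rem : ℕ → ℕ
  rem x = suc a ∸ x

  keepOnes : ℕ → ℕ → ℕ → ℚ
  keepOnes x i j = peel (rem x) γ (heCoeff α i (j ∸ x))

  dropOne : ℕ → ℕ → ℕ → ℚ
  dropOne x i j = atPredIfPos (rem x) i (λ i′ → peel (rem x ∸ 1) γ (heCoeff α i′ (j ∸ x)))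

  u : ℕ → ℚ
  u x = peel (rem x) γ (λ γ′ → 𝟙 (x ≤ᵇ k) * altHeCoeff α (k ∸ x) γ′)

  v : ℕ → ℚ
  v x = ∑ℕ (suc k) (λ j → 𝟙 (x ≤ᵇ j) * (sign (k ∸ j) * dropOne x (k ∸ j) j))

  keepOnes-sum : ∀ x → ∑ℕ (suc k) (λ j → 𝟙 (x ≤ᵇ j) * (sign (k ∸ j) * keepOnes x (k ∸ j) j)) ≡ u x
  keepOnes-sum x = begin
      ∑ℕ (suc k) (λ j → 𝟙 (x ≤ᵇ j) * (sign (k ∸ j) * keepOnes x (k ∸ j) j))
        ≡⟨ ∑ℕ-from k x (λ j → sign (k ∸ j) * keepOnes x (k ∸ j) j) ⟩
      𝟙 (x ≤ᵇ k) * ∑ℕ (suc (k ∸ x)) (λ j′ → sign (k ∸ (x ℕ.+ j′)) * keepOnes x (k ∸ (x ℕ.+ j′)) (x ℕ.+ j′))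
        ≡⟨ cong (𝟙 (x ≤ᵇ k) *_) (∑ℕ-cong (suc (k ∸ x)) (λ j′ _ → trans
             (cong₂ (λ t w → sign t * peel (rem x) γ (heCoeff α t w)) (sym (ℕ.∸-+-assoc k x j′)) (ℕ.m+n∸m≡n x j′))
             (sym (peel-* (rem x) γ (sign (k ∸ x ∸ j′)) (heCoeff α (k ∸ x ∸ j′) j′))))) ⟩
      𝟙 (x ≤ᵇ k) * ∑ℕ (suc (k ∸ x)) (λ j′ → peel (rem x) γ (λ γ′ → sign (k ∸ x ∸ j′) * heCoeff α (k ∸ x ∸ j′) j′ γ′))
        ≡⟨ cong (𝟙 (x ≤ᵇ k) *_) (sym (peel-∑ℕ (suc (k ∸ x)) (rem x) γ
             (λ j′ γ′ → sign (k ∸ x ∸ j′) * heCoeff α (k ∸ x ∸ j′) j′ γ′))) ⟩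
      𝟙 (x ≤ᵇ k) * peel (rem x) γ (altHeCoeff α (k ∸ x))
        ≡⟨ sym (peel-* (rem x) γ (𝟙 (x ≤ᵇ k)) (altHeCoeff α (k ∸ x))) ⟩
      u x ∎
    where open ≡-Reasoning

  v≡-u : ∀ x → x ≤ a → v x ≡ - u (suc x)
  v≡-u x x≤a = begin
      v x
        ≡⟨ ∑ℕ-cong (suc k) (λ j _ → cong (λ t → 𝟙 (x ≤ᵇ j) * (sign (k ∸ j) *
             atPredIfPos t (k ∸ j) (λ i′ → peel (t ∸ 1) γ (heCoeff α i′ (j ∸ x))))) (ℕ.+-∸-assoc 1 x≤a)) ⟩
      ∑ℕ (suc k) (λ j → 𝟙 (x ≤ᵇ j) * (sign (k ∸ j) * atPred (k ∸ j) (f j)))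
        ≡⟨ ∑ℕ-cong (suc k) (λ j _ → trans (cong (𝟙 (x ≤ᵇ j) *_) (sign-atPred (k ∸ j) (f j)))
             (sym (neg-distribʳ-* (𝟙 (x ≤ᵇ j)) (atPred (k ∸ j) (signed j))))) ⟩
      ∑ℕ (suc k) (λ j → - (𝟙 (x ≤ᵇ j) * atPred (k ∸ j) (signed j)))
        ≡⟨ ∑ℕ-neg (suc k) (λ j → 𝟙 (x ≤ᵇ j) * atPred (k ∸ j) (signed j)) ⟩
      - ∑ℕ (suc k) (λ j → 𝟙 (x ≤ᵇ j) * atPred (k ∸ j) (signed j))
        ≡⟨ cong -_ (∑ℕ-from-atPred k x signed) ⟩
      - (𝟙 (suc x ≤ᵇ k) * ∑ℕ (suc (k ∸ suc x)) (λ j′ → signed (x ℕ.+ j′) (k ∸ suc x ∸ j′)))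
        ≡⟨ cong (λ s → - (𝟙 (suc x ≤ᵇ k) * s)) (∑ℕ-cong (suc (k ∸ suc x)) (λ j′ _ → trans
             (cong (λ w → sign (k ∸ suc x ∸ j′) * peel (a ∸ x) γ (heCoeff α (k ∸ suc x ∸ j′) w)) (ℕ.m+n∸m≡n x j′))
             (sym (peel-* (a ∸ x) γ (sign (k ∸ suc x ∸ j′)) (heCoeff α (k ∸ suc x ∸ j′) j′))))) ⟩
      - (𝟙 (suc x ≤ᵇ k) * ∑ℕ (suc (k ∸ suc x)) (λ j′ →
          peel (a ∸ x) γ (λ γ′ → sign (k ∸ suc x ∸ j′) * heCoeff α (k ∸ suc x ∸ j′) j′ γ′)))
        ≡⟨ cong (λ s → - (𝟙 (suc x ≤ᵇ k) * s)) (sym (peel-∑ℕ (suc (k ∸ suc x)) (a ∸ x) γ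
             (λ j′ γ′ → sign (k ∸ suc x ∸ j′) * heCoeff α (k ∸ suc x ∸ j′) j′ γ′))) ⟩
      - (𝟙 (suc x ≤ᵇ k) * peel (a ∸ x) γ (altHeCoeff α (k ∸ suc x)))
        ≡⟨ cong -_ (sym (peel-* (a ∸ x) γ (𝟙 (suc x ≤ᵇ k)) (altHeCoeff α (k ∸ suc x)))) ⟩
      - u (suc x) ∎
    where
    open ≡-Reasoning
    f : ℕ → ℕ → ℚ
    f j i′ = peel (a ∸ x) γ (heCoeff α i′ (j ∸ x))
    signed : ℕ → ℕ → ℚ
    signed j i′ = sign i′ * f j i′

  v-last : v (suc a) ≡ 0ℚ
  v-last = ∑ℕ-zero (suc k) (λ j _ → trans
    (cong (λ t → 𝟙 (suc a ≤ᵇ j) * (sign (k ∸ j) *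
      atPredIfPos t (k ∸ j) (λ i′ → peel (t ∸ 1) γ (heCoeff α i′ (j ∸ suc a))))) (ℕ.n∸n≡0 a))
    (trans (cong (𝟙 (suc a ≤ᵇ j) *_) (*-zeroʳ (sign (k ∸ j)))) (*-zeroʳ (𝟙 (suc a ≤ᵇ j)))))

  altHeCoeff-∷ : altHeCoeff (suc a ∷ α) k γ ≡ 𝟙 (k ≡ᵇ 0) * δ (suc a ∷ α) γ
  altHeCoeff-∷ = begin
      ∑ℕ (suc k) (λ j → sign (k ∸ j) * heCoeff (suc a ∷ α) (k ∸ j) j γ)
        ≡⟨ ∑ℕ-cong (suc k) (λ j _ → trans (cong (sign (k ∸ j) *_) (heCoeff-∷ a α (k ∸ j) j pγ))
             (trans (∑ℕ-distribˡ (suc (suc a)) (sign (k ∸ j))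
                       (λ x → 𝟙 (x ≤ᵇ j) * (keepOnes x (k ∸ j) j + dropOne x (k ∸ j) j)))
               (∑ℕ-cong (suc (suc a)) (λ x _ →
               distribute (sign (k ∸ j)) (𝟙 (x ≤ᵇ j)) (keepOnes x (k ∸ j) j) (dropOne x (k ∸ j) j))))) ⟩
      ∑ℕ (suc k) (λ j → ∑ℕ (suc (suc a)) (λ x → term₁ x j + term₂ x j))
        ≡⟨ ∑ℕ-swap (suc k) (suc (suc a)) (λ j x → term₁ x j + term₂ x j) ⟩
      ∑ℕ (suc (suc a)) (λ x → ∑ℕ (suc k) (λ j → term₁ x j + term₂ x j))
        ≡⟨ ∑ℕ-cong (suc (suc a)) (λ x _ →
             trans (∑ℕ-+ (suc k) (λ j → term₁ x j) (λ j → term₂ x j)) (cong (_+ v x) (keepOnes-sum x))) ⟩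
      ∑ℕ (suc (suc a)) (λ x → u x + v x)
        ≡⟨ ∑ℕ-telescope (suc a) u v (λ x x<sa → v≡-u x (ℕ.≤-pred x<sa)) v-last ⟩
      u 0
        ≡⟨ peel-congᶜ (suc a) pγ (λ γ′ pγ′ → trans (*-identityˡ _) (hyp k pγ′)) ⟩
      peel (suc a) γ (λ γ′ → 𝟙 (k ≡ᵇ 0) * δ α γ′)
        ≡⟨ peel-* (suc a) γ (𝟙 (k ≡ᵇ 0)) (δ α) ⟩
      𝟙 (k ≡ᵇ 0) * peel (suc a) γ (δ α)
        ≡⟨ cong (𝟙 (k ≡ᵇ 0) *_) (sym (δ-peel a α γ)) ⟩
      𝟙 (k ≡ᵇ 0) * δ (suc a ∷ α) γ ∎
    where
    open ≡-Reasoning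
    term₁ term₂ : ℕ → ℕ → ℚ
    term₁ x j = 𝟙 (x ≤ᵇ j) * (sign (k ∸ j) * keepOnes x (k ∸ j) j)
    term₂ x j = 𝟙 (x ≤ᵇ j) * (sign (k ∸ j) * dropOne x (k ∸ j) j)
    distribute : ∀ s b t₁ t₂ → s * (b * (t₁ + t₂)) ≡ b * (s * t₁) + b * (s * t₂)
    distribute = solve 4 (λ s b t₁ t₂ → s :* (b :* (t₁ :+ t₂)) := b :* (s :* t₁) :+ b :* (s :* t₂)) refl

altHeCoeff≡δ : ∀ {α} → IsComp α → ∀ k {γ} → IsComp γ → altHeCoeff α k γ ≡ 𝟙 (k ≡ᵇ 0) * δ α γ
altHeCoeff≡δ [] k {γ} _ = altHeCoeff-[] k γ
altHeCoeff≡δ {suc a ∷ α} (_ ∷ pα) k pγ = AltHeCoeff-∷.altHeCoeff-∷ a α k pγ (λ k′ → altHeCoeff≡δ pα k′)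

Homogeneous : ℕ → LinComb → Set
Homogeneous d X = All (λ p → proj₂ p ⊨ d) X

M-homogeneous : ∀ {γ} → IsComp γ → Homogeneous (sum γ) (M γ)
M-homogeneous pγ = (pγ , refl) ∷ []

qmul-homogeneous : ∀ {d e F X} → Homogeneous d F → Homogeneous e X → Homogeneous (d ℕ.+ e) (qmul F X)
qmul-homogeneous {d} {e} {F} {X} hF hX = All.concat⁺ (All.map⁺ (All.map (λ {p} → row {p}) hF))
  where
  entry : ∀ {p q} → proj₂ p ⊨ d → proj₂ q ⊨ e →
    Homogeneous (d ℕ.+ e) (map (λ ζ → (proj₁ p * proj₁ q , ζ)) (qsh (proj₂ p) (proj₂ q)))
  entry (pα , refl) (pβ , refl) = All.map⁺ (qsh-⊨ pα pβ)
  row : ∀ {p} → proj₂ p ⊨ d →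
    Homogeneous (d ℕ.+ e) (concatMap (λ q → map (λ ζ → (proj₁ p * proj₁ q , ζ)) (qsh (proj₂ p) (proj₂ q))) X)
  row {p} p⊨ = All.concat⁺ (All.map⁺ (All.map (λ {q} → entry {p} {q} p⊨) hX))

pair-H-degree-mismatch : ∀ {d} α X → Homogeneous d X → sum α ≢ d → pair (H α) X ≡ 0ℚ
pair-H-degree-mismatch α X hX ne = trans (pair-H α X)
  (∑-zeroᴬ hX (λ q q⊨ → trans (cong (proj₁ q *_) (δ-≢ α (proj₂ q) (λ { refl → ne (proj₂ q⊨) }))) (*-zeroʳ (proj₁ q))))

eat-all : ∀ {a β} → β ⊨ a → eat a β ≡ just []
eat-all {β = []} (_ , refl) = refl
eat-all {β = zero ∷ β} ((() ∷ _) , _)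
eat-all {β = suc b ∷ β} ((_ ∷ pβ) , refl)
  rewrite Equivalence.to T-≡ (ℕ.≤⇒≤ᵇ (s≤s (ℕ.m≤m+n b (sum β)))) | ℕ.m+n∸m≡n b (sum β) = eat-all (pβ , refl)

refines-single : ∀ {β a} → β ⊨ a → refines β (a ∷ []) ≡ true
refines-single {[]} β⊨a rewrite eat-all β⊨a = refl
refines-single {b ∷ β} β⊨a rewrite eat-all β⊨a = refl

refines-ones-refl : ∀ t → refines (ones t) (ones t) ≡ true
refines-ones-refl zero = refl
refines-ones-refl (suc t) = refines-ones-refl t

refines-ones : ∀ t {β} → IsComp β → refines β (ones t) ≡ true → β ≡ ones t
refines-ones zero {[]} _ _ = refl
refines-ones zero {b ∷ β} _ ()
refines-ones (suc t) {[]} _ ()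
refines-ones (suc t) {zero ∷ β} (() ∷ _) e
refines-ones (suc t) {suc zero ∷ β} (_ ∷ pβ) e = cong (1 ∷_) (refines-ones t pβ e)
refines-ones (suc t) {suc (suc b) ∷ β} _ ()

Fund-homogeneous : ∀ α → Homogeneous (sum α) (Fund α)
Fund-homogeneous α = All.concat⁺ (All.map⁺ (All.map kept (comps-⊨ (sum α))))
  where
  kept : ∀ {β} → β ⊨ sum α → Homogeneous (sum α) (if refines β α then M β else [])
  kept {β} β⊨ with refines β α
  ... | true = β⊨ ∷ []
  ... | false = []

sum-ones : ∀ t → sum (ones t) ≡ t
sum-ones zero = refl
sum-ones (suc t) = cong suc (sum-ones t)

Fs-homogeneous : ∀ s → Homogeneous s (Fs s)
Fs-homogeneous zero = Fund-homogeneous []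
Fs-homogeneous (suc s) =
  subst (λ n → Homogeneous n (Fs (suc s))) (cong suc (ℕ.+-identityʳ s)) (Fund-homogeneous (suc s ∷ []))

F1-homogeneous : ∀ t → Homogeneous t (F1 t)
F1-homogeneous t = subst (λ n → Homogeneous n (F1 t)) (sum-ones t) (Fund-homogeneous (ones t))

∑-Fs : ∀ s (h : ℚ × Comp → ℚ) → ∑ h (Fs s) ≡ ∑ (λ β → h (1ℚ , β)) (comps s)
∑-Fs zero h = refl
∑-Fs (suc s) h = trans (∑-concatMap h _ (comps (suc s ℕ.+ 0)))
  (trans (∑-congᴬ (comps-⊨ (suc s ℕ.+ 0)) single)
    (cong (λ n → ∑ (λ β → h (1ℚ , β)) (comps n)) (cong suc (ℕ.+-identityʳ s))))
  where
  single : ∀ β → β ⊨ suc s ℕ.+ 0 → ∑ h (if refines β (suc s ∷ []) then M β else []) ≡ h (1ℚ , β)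
  single β (pβ , e) rewrite refines-single (pβ , trans e (cong suc (ℕ.+-identityʳ s))) = +-identityʳ _

∑-F1 : ∀ t (h : ℚ × Comp → ℚ) → ∑ h (F1 t) ≡ h (1ℚ , ones t)
∑-F1 t h = trans (∑-concatMap h _ (comps (sum (ones t))))
  (trans (∑-congᴬ (comps-⊨ (sum (ones t))) onlyOnes) (∑-comps-δ (ones t) (λ β → h (1ℚ , β)) (ones-comp t , refl)))
  where
  onlyOnes : ∀ β → β ⊨ sum (ones t) → ∑ h (if refines β (ones t) then M β else []) ≡ h (1ℚ , β) * δ β (ones t)
  onlyOnes β (pβ , _) with refines β (ones t) in eq
  ... | true rewrite refines-ones t pβ eq =
    trans (+-identityʳ _) (sym (trans (cong (h (1ℚ , ones t) *_) (δ-refl (ones t))) (*-identityʳ (h (1ℚ , ones t)))))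
  ... | false = sym (trans (cong (h (1ℚ , β) *_) (δ-≢ β (ones t) β≢)) (*-zeroʳ (h (1ℚ , β))))
    where
    β≢ : β ≢ ones t
    β≢ refl with () ← trans (sym eq) (refines-ones-refl t)

-- The adjoint F^⊥

∑-qmul : ∀ (h : ℚ × Comp → ℚ) F X →
  ∑ h (qmul F X) ≡ ∑ (λ p → ∑ (λ q → qshSum (λ ζ → h (proj₁ p * proj₁ q , ζ)) (proj₂ p) (proj₂ q)) X) F
∑-qmul h F X = trans (∑-concatMap h row F) (∑-cong (λ p → trans (∑-concatMap h (entry p) X)
  (∑-cong (λ q → ∑-map h (λ ζ → (proj₁ p * proj₁ q , ζ)) (qsh (proj₂ p) (proj₂ q))) X)) F)
  where
  entry : ℚ × Comp → ℚ × Comp → LinComb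
  entry p q = map (λ ζ → (proj₁ p * proj₁ q , ζ)) (qsh (proj₂ p) (proj₂ q))
  row : ℚ × Comp → LinComb
  row p = concatMap (entry p) X

pair-qmul : ∀ G F X →
  pair G (qmul F X) ≡ ∑ (λ p → ∑ (λ q → proj₁ p * proj₁ q * qshSum (coeff G) (proj₂ p) (proj₂ q)) X) F
pair-qmul G F X = trans (pair-coeff G (qmul F X)) (trans (∑-qmul (λ y → proj₁ y * coeff G (proj₂ y)) F X)
  (∑-cong (λ p → ∑-cong (λ q → sym (∑-distribˡ (proj₁ p * proj₁ q) (coeff G) (qsh (proj₂ p) (proj₂ q)))) X) F))

pair-qmul-M : ∀ G F β → pair G (qmul F (M β)) ≡ ∑ (λ p → proj₁ p * qshSum (coeff G) (proj₂ p) β) F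
pair-qmul-M G F β = trans (pair-qmul G F (M β))
  (∑-cong (λ p → trans (+-identityʳ _) (cong (_* qshSum (coeff G) (proj₂ p) β) (*-identityʳ (proj₁ p)))) F)

pair-qmul-linʳ : ∀ G F X → pair G (qmul F X) ≡ ∑ (λ q → proj₁ q * pair G (qmul F (M (proj₂ q)))) X
pair-qmul-linʳ G F X = begin
    pair G (qmul F X)
      ≡⟨ pair-qmul G F X ⟩
    ∑ (λ p → ∑ (λ q → proj₁ p * proj₁ q * Q p q) X) F
      ≡⟨ ∑-swap _ F X ⟩
    ∑ (λ q → ∑ (λ p → proj₁ p * proj₁ q * Q p q) F) X
      ≡⟨ ∑-cong (λ q → trans (∑-cong (λ p → reorder (proj₁ p) (proj₁ q) (Q p q)) F)
           (sym (∑-distribˡ (proj₁ q) (λ p → proj₁ p * Q p q) F))) X ⟩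
    ∑ (λ q → proj₁ q * ∑ (λ p → proj₁ p * Q p q) F) X
      ≡⟨ ∑-cong (λ q → cong (proj₁ q *_) (sym (pair-qmul-M G F (proj₂ q)))) X ⟩
    ∑ (λ q → proj₁ q * pair G (qmul F (M (proj₂ q)))) X ∎
  where
  open ≡-Reasoning
  Q : ℚ × Comp → ℚ × Comp → ℚ
  Q p q = qshSum (coeff G) (proj₂ p) (proj₂ q)
  reorder : ∀ a b c → a * b * c ≡ b * (a * c)
  reorder = solve 3 (λ a b c → a :* b :* c := b :* (a :* c)) refl

pair-H-Fs-F1-M : ∀ α s t γ → pair (H α) (qmul (Fs s) (qmul (F1 t) (M γ))) ≡ heCoeff α t s γ
pair-H-Fs-F1-M α s t γ = begin
    pair (H α) (qmul (Fs s) Y)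
      ≡⟨ pair-qmul (H α) (Fs s) Y ⟩
    ∑ (λ p → ∑ (λ q → proj₁ p * proj₁ q * qshSum (coeff (H α)) (proj₂ p) (proj₂ q)) Y) (Fs s)
      ≡⟨ ∑-Fs s (λ p → ∑ (λ q → proj₁ p * proj₁ q * qshSum (coeff (H α)) (proj₂ p) (proj₂ q)) Y) ⟩
    ∑ (λ β → ∑ (λ q → 1ℚ * proj₁ q * qshSum (coeff (H α)) β (proj₂ q)) Y) (comps s)
      ≡⟨ ∑-cong (λ β → trans (∑-qmul (entry β) (F1 t) (M γ))
           (trans (∑-F1 t (λ e → ∑ (λ q → qshSum (λ ζ → entry β (proj₁ e * proj₁ q , ζ)) (proj₂ e) (proj₂ q)) (M γ)))
             (trans (+-identityʳ _) (∑-cong (λ ζ → unitCoeff β ζ) (qsh (ones t) γ))))) (comps s) ⟩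
    ∑ (λ β → tripleCoeff α β (ones t) γ) (comps s) ∎
  where
  open ≡-Reasoning
  Y = qmul (F1 t) (M γ)
  entry : Comp → ℚ × Comp → ℚ
  entry β q = 1ℚ * proj₁ q * qshSum (coeff (H α)) β (proj₂ q)
  unitCoeff : ∀ β ζ → entry β (1ℚ * 1ℚ , ζ) ≡ qshSum (δ α) β ζ
  unitCoeff β ζ = trans (cong (_* qshSum (coeff (H α)) β ζ) (trans (*-identityˡ (1ℚ * 1ℚ)) (*-identityˡ 1ℚ)))
    (trans (*-identityˡ _) (∑-cong (coeff-H α) (qsh β ζ)))

perpWeight : QSym → ℚ × Comp → Comp → ℚ
perpWeight F p β′ = proj₁ p * pair (H (proj₂ p)) (qmul F (M β′))

coeff-perp-∑ : ∀ F G β →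
  coeff (perp F G) β ≡ ∑ (λ p → ∑ (λ β′ → perpWeight F p β′ * δ β′ β) (compsUpTo (sum (proj₂ p)))) G
coeff-perp-∑ F G β = trans (coeff-concatMap row G β)
  (∑-cong (λ p → ∑-map (λ r → proj₁ r * δ (proj₂ r) β) (λ β′ → (perpWeight F p β′ , β′))
    (compsUpTo (sum (proj₂ p)))) G)
  where
  row : ℚ × Comp → LinComb
  row p = map (λ β′ → (perpWeight F p β′ , β′)) (compsUpTo (sum (proj₂ p)))

coeff-perp : ∀ {f} F G β → Homogeneous f F → IsComp β → coeff (perp F G) β ≡ pair G (qmul F (M β))
coeff-perp {f} F G β hF pβ = begin
    coeff (perp F G) β
      ≡⟨ coeff-perp-∑ F G β ⟩
    ∑ (λ p → ∑ (λ β′ → perpWeight F p β′ * δ β′ β) (compsUpTo (sum (proj₂ p)))) G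
      ≡⟨ ∑-cong (λ p → trans (∑-compsUpTo-δ β (sum (proj₂ p)) (perpWeight F p) pβ) (inDegree p)) G ⟩
    ∑ (λ p → proj₁ p * pair (H (proj₂ p)) (qmul F (M β))) G
      ≡⟨ sym (pair-lin G (qmul F (M β))) ⟩
    pair G (qmul F (M β)) ∎
  where
  open ≡-Reasoning
  inDegree : ∀ p → 𝟙 (sum β ≤ᵇ sum (proj₂ p)) * perpWeight F p β ≡ perpWeight F p β
  inDegree (c , α) with sum β ℕ.≤? sum α
  ... | yes le = trans (cong (_* perpWeight F (c , α) β) (𝟙-≤ le)) (*-identityˡ _)
  ... | no nle = trans (cong (_* perpWeight F (c , α) β) (𝟙-≰ nle)) (trans (*-zeroˡ (perpWeight F (c , α) β))
      (sym (trans (cong (c *_) (pair-H-degree-mismatch α (qmul F (M β)) (qmul-homogeneous hF (M-homogeneous pβ))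
        (λ e → nle (subst (sum β ≤_) (sym e) (ℕ.m≤n+m (sum β) f))))) (*-zeroʳ c))))

coeff-perp-noncomp : ∀ F G β → ¬ IsComp β → coeff (perp F G) β ≡ 0ℚ
coeff-perp-noncomp F G β ¬pβ = trans (coeff-perp-∑ F G β) (∑-zero (λ p →
  ∑-zeroᴬ (compsUpTo-IsComp (sum (proj₂ p))) (λ β′ pβ′ →
    trans (cong (perpWeight F p β′ *_) (δ-≢ β′ β (λ { refl → ¬pβ pβ′ }))) (*-zeroʳ (perpWeight F p β′)))) G)

perp-adjoint : ∀ {f e} F G D → Homogeneous f F → Homogeneous e D → pair (perp F G) D ≡ pair G (qmul F D)
perp-adjoint F G D hF hD = begin
    pair (perp F G) D
      ≡⟨ pair-coeff (perp F G) D ⟩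
    ∑ (λ q → proj₁ q * coeff (perp F G) (proj₂ q)) D
      ≡⟨ ∑-congᴬ hD (λ q q⊨ → cong (proj₁ q *_) (coeff-perp F G (proj₂ q) hF (proj₁ q⊨))) ⟩
    ∑ (λ q → proj₁ q * pair G (qmul F (M (proj₂ q)))) D
      ≡⟨ sym (pair-qmul-linʳ G F D) ⟩
    pair G (qmul F D) ∎
  where open ≡-Reasoning

-- The operators 𝔹ₘ

coeff-Hmul-[] : ∀ m G → coeff (Hmul (suc m) G) [] ≡ 0ℚ
coeff-Hmul-[] m G = trans (∑-map _ _ G)
  (∑-zero (λ p → trans (cong (proj₁ p *_) (δ-∷-[] (suc m) (proj₂ p))) (*-zeroʳ (proj₁ p))) G)

coeff-Hmul-∷ : ∀ m G x γ → coeff (Hmul (suc m) G) (x ∷ γ) ≡ δℕ (suc m) x * coeff G γ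
coeff-Hmul-∷ m G x γ = trans (∑-map _ _ G) (trans (∑-cong (λ p → trans (cong (proj₁ p *_) (δ-∷ (suc m) x (proj₂ p) γ))
    (solve 3 (λ a b c → a :* (b :* c) := b :* (a :* c)) refl (proj₁ p) (δℕ (suc m) x) (δ (proj₂ p) γ))) G)
  (sym (∑-distribˡ (δℕ (suc m) x) _ G)))

deg-bound : ∀ G → All (λ p → sum (proj₂ p) ≤ deg G) G
deg-bound [] = []
deg-bound (p ∷ G) = ℕ.m≤m⊔n (sum (proj₂ p)) (deg G)
  ∷ All.map (λ h → ℕ.≤-trans h (ℕ.m≤n⊔m (sum (proj₂ p)) (deg G))) (deg-bound G)

coeff-above-deg : ∀ G γ → deg G < sum γ → coeff G γ ≡ 0ℚ
coeff-above-deg G γ lt = ∑-zeroᴬ (deg-bound G) (λ p h →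
  trans (cong (proj₁ p *_) (δ-≢ (proj₂ p) γ (λ e → ℕ.<-irrefl (cong sum e) (ℕ.≤-<-trans h lt)))) (*-zeroʳ (proj₁ p)))

pair-above-deg : ∀ {d} G X → Homogeneous d X → deg G < d → pair G X ≡ 0ℚ
pair-above-deg G X hX lt = trans (pair-coeff G X) (∑-zeroᴬ hX (λ q q⊨ →
  trans (cong (proj₁ q *_) (coeff-above-deg G (proj₂ q) (subst (deg G <_) (sym (proj₂ q⊨)) lt))) (*-zeroʳ (proj₁ q))))

perp-F1-above-deg : ∀ i G γ → deg G < i → coeff (perp (F1 i) G) γ ≡ 0ℚ
perp-F1-above-deg i G γ lt with all? (0 ℕ.<?_) γ
... | yes pγ = trans (coeff-perp (F1 i) G γ (F1-homogeneous i) pγ)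
  (pair-above-deg G _ (qmul-homogeneous (F1-homogeneous i) (M-homogeneous pγ)) (ℕ.<-≤-trans lt (ℕ.m≤m+n i (sum γ))))
... | no ¬pγ = coeff-perp-noncomp (F1 i) G γ ¬pγ

coeff-B-[] : ∀ m G → coeff (B (suc m) G) [] ≡ 0ℚ
coeff-B-[] m G =
  trans (coeff-concatMap (λ i → scale (sign i) (Hmul (suc m ℕ.+ i) (perp (F1 i) G))) (upTo (suc (deg G))) [])
  (∑-zero (λ i → trans (coeff-scale (sign i) (Hmul (suc m ℕ.+ i) (perp (F1 i) G)) [])
    (trans (cong (sign i *_) (coeff-Hmul-[] (m ℕ.+ i) (perp (F1 i) G))) (*-zeroʳ (sign i)))) (upTo (suc (deg G))))

coeff-B-∷ : ∀ m G x γ →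
  coeff (B (suc m) G) (x ∷ γ) ≡ 𝟙 (suc m ≤ᵇ x) * (sign (x ∸ suc m) * coeff (perp (F1 (x ∸ suc m)) G) γ)
coeff-B-∷ m G x γ = begin
    coeff (B (suc m) G) (x ∷ γ)
      ≡⟨ coeff-concatMap (λ i → scale (sign i) (Hmul (suc m ℕ.+ i) (perp (F1 i) G))) (upTo (suc (deg G))) (x ∷ γ) ⟩
    ∑ (λ i → coeff (scale (sign i) (Hmul (suc m ℕ.+ i) (perp (F1 i) G))) (x ∷ γ)) (upTo (suc (deg G)))
      ≡⟨ ∑-cong (λ i → trans (coeff-scale (sign i) (Hmul (suc m ℕ.+ i) (perp (F1 i) G)) (x ∷ γ))
           (cong (sign i *_) (coeff-Hmul-∷ (m ℕ.+ i) (perp (F1 i) G) x γ))) (upTo (suc (deg G))) ⟩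
    ∑ (λ i → sign i * (δℕ (suc m ℕ.+ i) x * c i)) (upTo (suc (deg G)))
      ≡⟨ ∑-upTo (λ i → sign i * (δℕ (suc m ℕ.+ i) x * c i)) (suc (deg G)) ⟩
    ∑ℕ (suc (deg G)) (λ i → sign i * (δℕ (suc m ℕ.+ i) x * c i))
      ≡⟨ byCases (suc m ℕ.≤? x) ⟩
    𝟙 (suc m ≤ᵇ x) * (sign (x ∸ suc m) * c (x ∸ suc m)) ∎
  where
  open ≡-Reasoning
  c : ℕ → ℚ
  c i = coeff (perp (F1 i) G) γ
  t = x ∸ suc m
  byCases : Dec (suc m ≤ x) →
    ∑ℕ (suc (deg G)) (λ i → sign i * (δℕ (suc m ℕ.+ i) x * c i)) ≡ 𝟙 (suc m ≤ᵇ x) * (sign t * c t)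
  byCases (yes le) = begin
      ∑ℕ (suc (deg G)) (λ i → sign i * (δℕ (suc m ℕ.+ i) x * c i))
        ≡⟨ ∑ℕ-cong (suc (deg G)) (λ i _ →
             trans (cong (λ e → sign i * (e * c i)) (trans (δℕ-+ˡ (suc m) i x le) (δℕ-sym i t)))
             (solve 3 (λ a b c → a :* (b :* c) := b :* (a :* c)) refl (sign i) (δℕ t i) (c i))) ⟩
      ∑ℕ (suc (deg G)) (λ i → δℕ t i * (sign i * c i))
        ≡⟨ inRange (t ℕ.<? suc (deg G)) ⟩
      sign t * c t
        ≡⟨ sym (trans (cong (_* (sign t * c t)) (𝟙-≤ le)) (*-identityˡ _)) ⟩
      𝟙 (suc m ≤ᵇ x) * (sign t * c t) ∎
    where
    inRange : Dec (t < suc (deg G)) → ∑ℕ (suc (deg G)) (λ i → δℕ t i * (sign i * c i)) ≡ sign t * c t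
    inRange (yes lt) = ∑ℕ-δℕ (suc (deg G)) (λ i → sign i * c i) lt
    inRange (no nlt) = trans (∑ℕ-δℕ-out (suc (deg G)) (λ i → sign i * c i) (ℕ.≮⇒≥ nlt))
      (sym (trans (cong (sign t *_) (perp-F1-above-deg t G γ (ℕ.≮⇒≥ nlt))) (*-zeroʳ (sign t))))
  byCases (no nle) = trans (∑ℕ-zero (suc (deg G)) (λ i _ →
      trans (cong (λ e → sign i * (e * c i))
              (δℕ-≢ (suc m ℕ.+ i) x (λ e → nle (subst (suc m ≤_) e (ℕ.m≤m+n (suc m) i)))))
        (trans (cong (sign i *_) (*-zeroˡ (c i))) (*-zeroʳ (sign i)))))
    (sym (trans (cong (_* (sign t * c t)) (𝟙-≰ nle)) (*-zeroˡ (sign t * c t))))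

-- Homogeneity in NSym is stated on coefficients, since perp lists compositions of every size up to
-- the degree, mostly with coefficient 0.

OnComps : LinComb → Set
OnComps G = All (IsComp ∘ proj₂) G

Homogeneousᶜ : ℕ → LinComb → Set
Homogeneousᶜ d G = ∀ γ → sum γ ≢ d → coeff G γ ≡ 0ℚ

coeff-noncomp : ∀ G γ → OnComps G → ¬ IsComp γ → coeff G γ ≡ 0ℚ
coeff-noncomp G γ cG ¬pγ = ∑-zeroᴬ cG (λ p pp →
  trans (cong (proj₁ p *_) (δ-≢ (proj₂ p) γ (λ { refl → ¬pγ pp }))) (*-zeroʳ (proj₁ p)))

H-homogeneousᶜ : ∀ α → Homogeneousᶜ (sum α) (H α)
H-homogeneousᶜ α γ ne = trans (coeff-H α γ) (δ-≢ α γ (λ { refl → ne refl }))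

pair-degree-mismatch : ∀ {d e} G X → Homogeneousᶜ d G → Homogeneous e X → e ≢ d → pair G X ≡ 0ℚ
pair-degree-mismatch G X hG hX ne = trans (pair-coeff G X) (∑-zeroᴬ hX (λ q q⊨ →
  trans (cong (proj₁ q *_) (hG (proj₂ q) (λ eq → ne (trans (sym (proj₂ q⊨)) eq)))) (*-zeroʳ (proj₁ q))))

coeff-perp-degree-mismatch : ∀ {d f} F G → Homogeneousᶜ d G → Homogeneous f F → ∀ β → f ℕ.+ sum β ≢ d →
  coeff (perp F G) β ≡ 0ℚ
coeff-perp-degree-mismatch F G hG hF β ne with all? (0 ℕ.<?_) β
... | yes pβ = trans (coeff-perp F G β hF pβ)
  (pair-degree-mismatch G (qmul F (M β)) hG (qmul-homogeneous hF (M-homogeneous pβ)) ne)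
... | no ¬pβ = coeff-perp-noncomp F G β ¬pβ

perp-Fs-homogeneousᶜ : ∀ {d} s G → Homogeneousᶜ d G → s ≤ d → Homogeneousᶜ (d ∸ s) (perp (Fs s) G)
perp-Fs-homogeneousᶜ {d} s G hG le β ne =
  coeff-perp-degree-mismatch (Fs s) G hG (Fs-homogeneous s) β
    (λ e → ne (trans (sym (ℕ.m+n∸m≡n s (sum β))) (cong (_∸ s) e)))

perp-≈ : ∀ {f} F {X Y} → Homogeneous f F → X ≈ Y → perp F X ≈ perp F Y
perp-≈ F {X} {Y} hF e = coeffwise atβ
  where
  atβ : ∀ β → coeff (perp F X) β ≡ coeff (perp F Y) β
  atβ β with all? (0 ℕ.<?_) β
  ... | yes pβ = trans (coeff-perp F X β hF pβ) (trans (pair-≈ e (qmul F (M β))) (sym (coeff-perp F Y β hF pβ)))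
  ... | no ¬pβ = trans (coeff-perp-noncomp F X β ¬pβ) (sym (coeff-perp-noncomp F Y β ¬pβ))

B-≈ : ∀ m {X Y} → X ≈ Y → B (suc m) X ≈ B (suc m) Y
B-≈ m {X} {Y} e = coeffwise atγ
  where
  atγ : ∀ γ → coeff (B (suc m) X) γ ≡ coeff (B (suc m) Y) γ
  atγ [] = trans (coeff-B-[] m X) (sym (coeff-B-[] m Y))
  atγ (x ∷ γ) = trans (coeff-B-∷ m X x γ) (trans (cong (λ c → 𝟙 (suc m ≤ᵇ x) * (sign (x ∸ suc m) * c))
    (coeff≡ (perp-≈ (F1 (x ∸ suc m)) (F1-homogeneous (x ∸ suc m)) e) γ)) (sym (coeff-B-∷ m Y x γ)))

perp-OnComps : ∀ F G → OnComps (perp F G)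
perp-OnComps F G = All.concat⁺ (All.map⁺ (All.universal (λ p → All.map⁺ (compsUpTo-IsComp (sum (proj₂ p)))) G))

B-OnComps : ∀ m G → OnComps (B (suc m) G)
B-OnComps m G = All.concat⁺ (All.map⁺ (All.universal
  (λ i → All.map⁺ (All.map⁺ (All.map (s≤s z≤n ∷_) (perp-OnComps (F1 i) G)))) (upTo (suc (deg G)))))

imm-OnComps : ∀ {γ} → IsComp γ → OnComps (imm γ)
imm-OnComps [] = [] ∷ []
imm-OnComps {suc m ∷ γ} (_ ∷ _) = B-OnComps m (imm γ)

imm-homogeneousᶜ : ∀ {γ} → IsComp γ → Homogeneousᶜ (sum γ) (imm γ)
imm-homogeneousᶜ [] = H-homogeneousᶜ []
imm-homogeneousᶜ {suc m ∷ γ} (_ ∷ pγ) [] _ = coeff-B-[] m (imm γ)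
imm-homogeneousᶜ {suc m ∷ γ} (_ ∷ pγ) (x ∷ ζ) ne with suc m ℕ.≤? x
... | yes le = trans (coeff-B-∷ m (imm γ) x ζ) (trans (cong (λ c → 𝟙 (suc m ≤ᵇ x) * (sign (x ∸ suc m) * c))
      (coeff-perp-degree-mismatch (F1 (x ∸ suc m)) (imm γ) (imm-homogeneousᶜ pγ) (F1-homogeneous (x ∸ suc m)) ζ ne′))
      (trans (cong (𝟙 (suc m ≤ᵇ x) *_) (*-zeroʳ (sign (x ∸ suc m)))) (*-zeroʳ (𝟙 (suc m ≤ᵇ x)))))
  where
  ne′ : x ∸ suc m ℕ.+ sum ζ ≢ sum γ
  ne′ e = ne (trans (cong (ℕ._+ sum ζ) (sym (ℕ.m+[n∸m]≡n le)))
    (trans (ℕ.+-assoc (suc m) (x ∸ suc m) (sum ζ)) (cong (suc m ℕ.+_) e)))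
... | no nle = trans (coeff-B-∷ m (imm γ) x ζ) (trans (cong (_* rest) (𝟙-≰ nle)) (*-zeroˡ rest))
  where rest = sign (x ∸ suc m) * coeff (perp (F1 (x ∸ suc m)) (imm γ)) ζ

-- H_(r+1) G = Σ_s 𝔹_(r+1+s) F_s^⊥ G for G homogeneous of degree n; on coefficients this is altHeCoeff≡δ.

module Hmul-expansion (r : ℕ) {G : NSym} {n : ℕ} (cG : OnComps G) (hG : Homogeneousᶜ n G) where

  expansion : NSym
  expansion = concatMap (λ s → B (suc r ℕ.+ s) (perp (Fs s) G)) (upTo (suc n))

  removed : ℕ → ℕ → Comp → ℚ
  removed x s γ = sign (x ∸ suc (r ℕ.+ s)) * coeff (perp (F1 (x ∸ suc (r ℕ.+ s))) (perp (Fs s) G)) γ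

  summand : ℕ → ℕ → Comp → ℚ
  summand x s γ = 𝟙 (suc (r ℕ.+ s) ≤ᵇ x) * removed x s γ

  coeff-expansion : ∀ x γ → coeff expansion (x ∷ γ) ≡ ∑ℕ (suc n) (λ s → summand x s γ)
  coeff-expansion x γ = trans (coeff-concatMap (λ s → B (suc r ℕ.+ s) (perp (Fs s) G)) (upTo (suc n)) (x ∷ γ))
    (trans (∑-cong (λ s → coeff-B-∷ (r ℕ.+ s) (perp (Fs s) G) x γ) (upTo (suc n)))
      (∑-upTo (λ s → summand x s γ) (suc n)))

  coeff-expansion-[] : coeff expansion [] ≡ 0ℚ
  coeff-expansion-[] = trans (coeff-concatMap (λ s → B (suc r ℕ.+ s) (perp (Fs s) G)) (upTo (suc n)) [])
    (∑-zero (λ s → coeff-B-[] (r ℕ.+ s) (perp (Fs s) G)) (upTo (suc n)))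

  pairing : ℕ → ℕ → Comp → ℚ
  pairing s t γ = pair G (qmul (Fs s) (qmul (F1 t) (M γ)))

  pairing-heCoeff : ∀ s t γ → pairing s t γ ≡ ∑ (λ p → proj₁ p * heCoeff (proj₂ p) t s γ) G
  pairing-heCoeff s t γ = trans (pair-lin G _) (∑-cong (λ p → cong (proj₁ p *_) (pair-H-Fs-F1-M (proj₂ p) s t γ)) G)

  pairing-above-deg : ∀ s t {γ} → IsComp γ → ¬ s ≤ n → pairing s t γ ≡ 0ℚ
  pairing-above-deg s t pγ s≰n = pair-degree-mismatch G _ hG
    (qmul-homogeneous (Fs-homogeneous s) (qmul-homogeneous (F1-homogeneous t) (M-homogeneous pγ)))
    (λ e → s≰n (subst (s ≤_) e (ℕ.m≤m+n s _)))

  coeff-expansion-pairings : ∀ k {γ} → IsComp γ →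
    coeff expansion (suc (r ℕ.+ k) ∷ γ) ≡ ∑ℕ (suc k) (λ s → sign (k ∸ s) * pairing s (k ∸ s) γ)
  coeff-expansion-pairings k {γ} pγ = begin
      coeff expansion (suc (r ℕ.+ k) ∷ γ)
        ≡⟨ coeff-expansion (suc (r ℕ.+ k)) γ ⟩
      ∑ℕ (suc n) (λ s → summand (suc (r ℕ.+ k)) s γ)
        ≡⟨ ∑ℕ-cong (suc n) (λ s _ → cong₂ (λ b t → 𝟙 b * (sign t * coeff (perp (F1 t) (perp (Fs s) G)) γ))
             (≤ᵇ-+ˡ (suc r) s k) (ℕ.[m+n]∸[m+o]≡n∸o r k s)) ⟩
      ∑ℕ (suc n) (λ s → 𝟙 (s ≤ᵇ k) * (sign (k ∸ s) * coeff (perp (F1 (k ∸ s)) (perp (Fs s) G)) γ))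
        ≡⟨ ∑ℕ-cong (suc n) (λ s _ → cong (λ c → 𝟙 (s ≤ᵇ k) * (sign (k ∸ s) * c))
             (trans (coeff-perp (F1 (k ∸ s)) (perp (Fs s) G) γ (F1-homogeneous (k ∸ s)) pγ)
               (perp-adjoint (Fs s) G _ (Fs-homogeneous s)
                 (qmul-homogeneous (F1-homogeneous (k ∸ s)) (M-homogeneous pγ))))) ⟩
      ∑ℕ (suc n) (λ s → 𝟙 (s ≤ᵇ k) * Y s)
        ≡⟨ ∑ℕ-𝟙≤-comm n k Y ⟩
      ∑ℕ (suc k) (λ s → 𝟙 (s ≤ᵇ n) * Y s)
        ≡⟨ ∑ℕ-cong (suc k) (λ s _ → inDegree s) ⟩
      ∑ℕ (suc k) Y ∎
    where
    open ≡-Reasoning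
    Y : ℕ → ℚ
    Y s = sign (k ∸ s) * pairing s (k ∸ s) γ
    inDegree : ∀ s → 𝟙 (s ≤ᵇ n) * Y s ≡ Y s
    inDegree s with s ℕ.≤? n
    ... | yes le = trans (cong (_* Y s) (𝟙-≤ le)) (*-identityˡ (Y s))
    ... | no nle = trans (cong (_* Y s) (𝟙-≰ nle)) (trans (*-zeroˡ (Y s))
      (sym (trans (cong (sign (k ∸ s) *_) (pairing-above-deg s (k ∸ s) pγ nle)) (*-zeroʳ (sign (k ∸ s))))))

  coeff-expansion-suc-+ : ∀ k {γ} → IsComp γ → coeff expansion (suc (r ℕ.+ k) ∷ γ) ≡ 𝟙 (k ≡ᵇ 0) * coeff G γ
  coeff-expansion-suc-+ k {γ} pγ = begin
      coeff expansion (suc (r ℕ.+ k) ∷ γ)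
        ≡⟨ coeff-expansion-pairings k pγ ⟩
      ∑ℕ (suc k) (λ s → sign (k ∸ s) * pairing s (k ∸ s) γ)
        ≡⟨ ∑ℕ-cong (suc k) (λ s _ → trans (cong (sign (k ∸ s) *_) (pairing-heCoeff s (k ∸ s) γ))
             (∑-distribˡ (sign (k ∸ s)) _ G)) ⟩
      ∑ℕ (suc k) (λ s → ∑ (λ p → sign (k ∸ s) * (proj₁ p * heCoeff (proj₂ p) (k ∸ s) s γ)) G)
        ≡⟨ ∑ℕ-∑ (suc k) (λ s p → sign (k ∸ s) * (proj₁ p * heCoeff (proj₂ p) (k ∸ s) s γ)) G ⟩
      ∑ (λ p → ∑ℕ (suc k) (λ s → sign (k ∸ s) * (proj₁ p * heCoeff (proj₂ p) (k ∸ s) s γ))) G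
        ≡⟨ ∑-cong (λ p → trans
             (∑ℕ-cong (suc k) (λ s _ → reorder (sign (k ∸ s)) (proj₁ p) (heCoeff (proj₂ p) (k ∸ s) s γ)))
             (sym (∑ℕ-distribˡ (suc k) (proj₁ p) (λ s → sign (k ∸ s) * heCoeff (proj₂ p) (k ∸ s) s γ)))) G ⟩
      ∑ (λ p → proj₁ p * altHeCoeff (proj₂ p) k γ) G
        ≡⟨ ∑-congᴬ cG (λ p pp → cong (proj₁ p *_) (altHeCoeff≡δ pp k pγ)) ⟩
      ∑ (λ p → proj₁ p * (𝟙 (k ≡ᵇ 0) * δ (proj₂ p) γ)) G
        ≡⟨ trans (∑-cong (λ p → reorder (proj₁ p) (𝟙 (k ≡ᵇ 0)) (δ (proj₂ p) γ)) G)
             (sym (∑-distribˡ (𝟙 (k ≡ᵇ 0)) _ G)) ⟩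
      𝟙 (k ≡ᵇ 0) * coeff G γ ∎
    where
    open ≡-Reasoning
    reorder : ∀ a b c → a * (b * c) ≡ b * (a * c)
    reorder = solve 3 (λ a b c → a :* (b :* c) := b :* (a :* c)) refl

  Hmul≈expansion : Hmul (suc r) G ≈ expansion
  Hmul≈expansion = coeffwise atγ
    where
    atγ : ∀ γ → coeff (Hmul (suc r) G) γ ≡ coeff expansion γ
    atγ [] = trans (coeff-Hmul-[] r G) (sym coeff-expansion-[])
    atγ (x ∷ γ) with all? (0 ℕ.<?_) γ | suc r ℕ.≤? x
    ... | no ¬pγ | _ = trans (coeff-Hmul-∷ r G x γ) (trans (cong (δℕ (suc r) x *_) (coeff-noncomp G γ cG ¬pγ))
      (trans (*-zeroʳ (δℕ (suc r) x)) (sym (trans (coeff-expansion x γ) (∑ℕ-zero (suc n) (λ s _ →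
        trans (cong (λ c → 𝟙 (suc (r ℕ.+ s) ≤ᵇ x) * (sign (x ∸ suc (r ℕ.+ s)) * c))
          (coeff-perp-noncomp (F1 (x ∸ suc (r ℕ.+ s))) (perp (Fs s) G) γ ¬pγ))
          (trans (cong (𝟙 (suc (r ℕ.+ s) ≤ᵇ x) *_) (*-zeroʳ (sign (x ∸ suc (r ℕ.+ s)))))
            (*-zeroʳ (𝟙 (suc (r ℕ.+ s) ≤ᵇ x))))))))))
    ... | yes pγ | yes le = subst (λ y → coeff (Hmul (suc r) G) (y ∷ γ) ≡ coeff expansion (y ∷ γ)) (ℕ.m+[n∸m]≡n le)
      (trans (coeff-Hmul-∷ r G (suc r ℕ.+ (x ∸ suc r)) γ)
        (trans (cong (_* coeff G γ) (δℕ-suc-+ r (x ∸ suc r))) (sym (coeff-expansion-suc-+ (x ∸ suc r) pγ))))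
    ... | yes pγ | no nle = trans (coeff-Hmul-∷ r G x γ) (trans (cong (_* coeff G γ)
        (δℕ-≢ (suc r) x (λ e → nle (subst (suc r ≤_) e ℕ.≤-refl)))) (trans (*-zeroˡ (coeff G γ))
      (sym (trans (coeff-expansion x γ) (∑ℕ-zero (suc n) (λ s _ →
        trans (cong (_* removed x s γ) (𝟙-≰ (λ le → nle (ℕ.≤-trans (s≤s (ℕ.m≤m+n r s)) le))))
          (*-zeroˡ (removed x s γ))))))))

immComb : List (ℚ × Comp) → NSym
immComb L = concatMap (λ p → scale (proj₁ p) (imm (proj₂ p))) L

coeff-immComb : ∀ L ζ → coeff (immComb L) ζ ≡ ∑ (λ p → proj₁ p * coeff (imm (proj₂ p)) ζ) L
coeff-immComb L ζ = trans (coeff-concatMap (λ p → scale (proj₁ p) (imm (proj₂ p))) L ζ)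
  (∑-cong (λ p → coeff-scale (proj₁ p) (imm (proj₂ p)) ζ) L)

pair-immComb : ∀ L D → pair (immComb L) D ≡ ∑ (λ p → proj₁ p * pair (imm (proj₂ p)) D) L
pair-immComb L D = trans (pair-concatMap (λ p → scale (proj₁ p) (imm (proj₂ p))) L D)
  (∑-cong (λ p → pair-scale (proj₁ p) (imm (proj₂ p)) D) L)

coeff-perp-immComb : ∀ {f} F L β → Homogeneous f F →
  coeff (perp F (immComb L)) β ≡ ∑ (λ p → proj₁ p * coeff (perp F (imm (proj₂ p))) β) L
coeff-perp-immComb F L β hF with all? (0 ℕ.<?_) β
... | yes pβ = trans (coeff-perp F (immComb L) β hF pβ) (trans (pair-immComb L (qmul F (M β)))
  (∑-cong (λ p → cong (proj₁ p *_) (sym (coeff-perp F (imm (proj₂ p)) β hF pβ))) L))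
... | no ¬pβ = trans (coeff-perp-noncomp F (immComb L) β ¬pβ)
  (sym (∑-zero (λ p → trans (cong (proj₁ p *_) (coeff-perp-noncomp F (imm (proj₂ p)) β ¬pβ)) (*-zeroʳ (proj₁ p))) L))

B-immComb : ∀ m L → B (suc m) (immComb L) ≈ immComb (map (map₂ (suc m ∷_)) L)
B-immComb m L = coeffwise atγ
  where
  atγ : ∀ γ → coeff (B (suc m) (immComb L)) γ ≡ coeff (immComb (map (map₂ (suc m ∷_)) L)) γ
  atγ [] = trans (coeff-B-[] m (immComb L)) (sym (trans (coeff-immComb (map (map₂ (suc m ∷_)) L) [])
    (trans (∑-map _ _ L)
      (∑-zero (λ p → trans (cong (proj₁ p *_) (coeff-B-[] m (imm (proj₂ p)))) (*-zeroʳ (proj₁ p))) L))))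
  atγ (x ∷ γ) = begin
      coeff (B (suc m) (immComb L)) (x ∷ γ)
        ≡⟨ coeff-B-∷ m (immComb L) x γ ⟩
      𝟙 (suc m ≤ᵇ x) * (sign t * coeff (perp (F1 t) (immComb L)) γ)
        ≡⟨ cong (λ c → 𝟙 (suc m ≤ᵇ x) * (sign t * c)) (coeff-perp-immComb (F1 t) L γ (F1-homogeneous t)) ⟩
      𝟙 (suc m ≤ᵇ x) * (sign t * ∑ (λ p → proj₁ p * c p) L)
        ≡⟨ trans (cong (𝟙 (suc m ≤ᵇ x) *_) (∑-distribˡ (sign t) _ L)) (∑-distribˡ (𝟙 (suc m ≤ᵇ x)) _ L) ⟩
      ∑ (λ p → 𝟙 (suc m ≤ᵇ x) * (sign t * (proj₁ p * c p))) L
        ≡⟨ ∑-cong (λ p → trans (reorder (𝟙 (suc m ≤ᵇ x)) (sign t) (proj₁ p) (c p))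
             (cong (proj₁ p *_) (sym (coeff-B-∷ m (imm (proj₂ p)) x γ)))) L ⟩
      ∑ (λ p → proj₁ p * coeff (imm (suc m ∷ proj₂ p)) (x ∷ γ)) L
        ≡⟨ sym (trans (coeff-immComb (map (map₂ (suc m ∷_)) L) (x ∷ γ)) (∑-map _ _ L)) ⟩
      coeff (immComb (map (map₂ (suc m ∷_)) L)) (x ∷ γ) ∎
    where
    open ≡-Reasoning
    t = x ∸ suc m
    c : ℚ × Comp → ℚ
    c p = coeff (perp (F1 t) (imm (proj₂ p))) γ
    reorder : ∀ a b c d → a * (b * (c * d)) ≡ c * (a * (b * d))
    reorder = solve 4 (λ a b c d → a :* (b :* (c :* d)) := c :* (a :* (b :* d))) refl

-- The immaculate basis

record InImmSpan (d : ℕ) (X : NSym) : Set where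
  constructor span
  field
    terms : List (ℚ × Comp)
    terms-homogeneous : Homogeneous d terms
    ≈immComb : X ≈ immComb terms
open InImmSpan

span-≈ : ∀ {d X Y} → X ≈ Y → InImmSpan d Y → InImmSpan d X
span-≈ e (span L hL e′) = span L hL (≈-trans e e′)

span-[] : ∀ {d} → InImmSpan d []
span-[] = span [] [] (coeffwise (λ _ → refl))

span-++ : ∀ {d X Y} → InImmSpan d X → InImmSpan d Y → InImmSpan d (X ++ Y)
span-++ {X = X} {Y} (span L hL e) (span L′ hL′ e′) = span (L ++ L′) (All.++⁺ hL hL′) (coeffwise (λ γ → begin
    coeff (X ++ Y) γ                           ≡⟨ coeff-++ X Y γ ⟩
    coeff X γ + coeff Y γ                      ≡⟨ cong₂ _+_ (coeff≡ e γ) (coeff≡ e′ γ) ⟩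
    coeff (immComb L) γ + coeff (immComb L′) γ ≡⟨ sym (coeff-++ (immComb L) (immComb L′) γ) ⟩
    coeff (immComb L ++ immComb L′) γ          ≡⟨ cong (λ Z → coeff Z γ) (sym (concatMap-++ _ L L′)) ⟩
    coeff (immComb (L ++ L′)) γ                ∎))
  where open ≡-Reasoning

span-scale : ∀ {d X} c → InImmSpan d X → InImmSpan d (scale c X)
span-scale {X = X} c (span L hL e) = span (map (map₁ (c *_)) L) (All.map⁺ hL) (coeffwise (λ γ → begin
    coeff (scale c X) γ
      ≡⟨ trans (coeff-scale c X γ) (cong (c *_) (trans (coeff≡ e γ) (coeff-immComb L γ))) ⟩
    c * ∑ (λ p → proj₁ p * coeff (imm (proj₂ p)) γ) L
      ≡⟨ trans (∑-distribˡ c _ L) (∑-cong (λ p → sym (*-assoc c (proj₁ p) _)) L) ⟩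
    ∑ (λ p → c * proj₁ p * coeff (imm (proj₂ p)) γ) L
      ≡⟨ sym (trans (coeff-immComb (map (map₁ (c *_)) L) γ) (∑-map _ _ L)) ⟩
    coeff (immComb (map (map₁ (c *_)) L)) γ ∎))
  where open ≡-Reasoning

span-concatMap : ∀ {d} {P : I → Set} {f : I → NSym} {xs : List I} →
  All P xs → (∀ x → P x → InImmSpan d (f x)) → InImmSpan d (concatMap f xs)
span-concatMap [] h = span-[]
span-concatMap {xs = x ∷ xs} (p ∷ ps) h = span-++ (h x p) (span-concatMap ps h)

span-B : ∀ {d X} m → InImmSpan d X → InImmSpan (suc m ℕ.+ d) (B (suc m) X)
span-B m (span L hL e) = span (map (map₂ (suc m ∷_)) L)
  (All.map⁺ (All.map (λ { (pα , refl) → (s≤s z≤n ∷ pα) , refl }) hL))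
  (≈-trans (B-≈ m e) (B-immComb m L))

≈-H-expansion : ∀ X d → OnComps X → Homogeneousᶜ d X → X ≈ concatMap (λ α → scale (coeff X α) (H α)) (comps d)
≈-H-expansion X d cX hX = coeffwise (λ γ → sym (begin
    coeff (concatMap (λ α → scale (coeff X α) (H α)) (comps d)) γ
      ≡⟨ coeff-concatMap (λ α → scale (coeff X α) (H α)) (comps d) γ ⟩
    ∑ (λ α → coeff (scale (coeff X α) (H α)) γ) (comps d)
      ≡⟨ ∑-cong (λ α → trans (coeff-scale (coeff X α) (H α) γ) (cong (coeff X α *_) (coeff-H α γ))) (comps d) ⟩
    ∑ (λ α → coeff X α * δ α γ) (comps d)
      ≡⟨ byCases γ (all? (0 ℕ.<?_) γ) (sum γ ℕ.≟ d) ⟩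
    coeff X γ ∎))
  where
  open ≡-Reasoning
  byCases : ∀ γ → Dec (IsComp γ) → Dec (sum γ ≡ d) → ∑ (λ α → coeff X α * δ α γ) (comps d) ≡ coeff X γ
  byCases γ (yes pγ) (yes e) = ∑-comps-δ γ (coeff X) (pγ , e)
  byCases γ (yes _) (no ne) = trans (∑-comps-δ-out γ d (coeff X) (ne ∘ proj₂)) (sym (hX γ ne))
  byCases γ (no ¬pγ) _ = trans (∑-comps-δ-out γ d (coeff X) (¬pγ ∘ proj₁)) (sym (coeff-noncomp X γ cX ¬pγ))

immSpan : ∀ d X → OnComps X → Homogeneousᶜ d X → InImmSpan d X
immSpan = <-rec (λ d → ∀ X → OnComps X → Homogeneousᶜ d X → InImmSpan d X) step
  where
  step : ∀ d → (∀ {d′} → d′ < d → ∀ X → OnComps X → Homogeneousᶜ d′ X → InImmSpan d′ X) →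
    ∀ X → OnComps X → Homogeneousᶜ d X → InImmSpan d X
  step d rec X cX hX = span-≈ (≈-H-expansion X d cX hX)
    (span-concatMap (comps-⊨ d) (λ α α⊨d → span-scale (coeff X α) (H-span α α⊨d)))
    where
    H-span : ∀ α → α ⊨ d → InImmSpan d (H α)
    H-span [] (_ , refl) = span (H []) (([] , refl) ∷ []) (coeffwise (λ γ →
      sym (trans (coeff-immComb (H []) γ) (trans (+-identityʳ _) (*-identityˡ _)))))
    H-span (zero ∷ α) ((() ∷ _) , _)
    H-span (suc a ∷ α) ((_ ∷ pα) , refl) = span-≈ (Hmul≈expansion a (pα ∷ []) (H-homogeneousᶜ α))
      (span-concatMap (All.applyUpTo⁺₁ id (suc (sum α)) id) term)
      where
      open Hmul-expansion using (Hmul≈expansion)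
      term : ∀ s → s < suc (sum α) → InImmSpan (suc a ℕ.+ sum α) (B (suc a ℕ.+ s) (perp (Fs s) (H α)))
      term s (s≤s s≤α) = subst (λ d′ → InImmSpan d′ (B (suc a ℕ.+ s) (perp (Fs s) (H α)))) degree
        (span-B (a ℕ.+ s) (rec smaller (perp (Fs s) (H α)) (perp-OnComps (Fs s) (H α))
          (perp-Fs-homogeneousᶜ s (H α) (H-homogeneousᶜ α) s≤α)))
        where
        degree : suc (a ℕ.+ s) ℕ.+ (sum α ∸ s) ≡ suc a ℕ.+ sum α
        degree = cong suc (trans (ℕ.+-assoc a s _) (cong (a ℕ.+_) (ℕ.m+[n∸m]≡n s≤α)))
        smaller : sum α ∸ s < suc a ℕ.+ sum α
        smaller = s≤s (ℕ.≤-trans (ℕ.m∸n≤m (sum α) s) (ℕ.m≤n+m (sum α) a))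

dual-homogeneous : ∀ {β D} → IsDualImm β D → Homogeneous (sum β) D
dual-homogeneous (hD , _) = All.tabulate hD

pair-span-dual : ∀ {d X β D} (S : InImmSpan d X) → IsDualImm β D → sum β ≡ d →
  pair X D ≡ ∑ (λ p → proj₁ p * δ (proj₂ p) β) (terms S)
pair-span-dual {β = β} {D} (span L hL e) (_ , dual) β⊨d =
  trans (pair-≈ e D) (trans (pair-immComb L D) (∑-congᴬ hL (λ p p⊨ →
    cong (proj₁ p *_) (dual (proj₂ p) (proj₁ p⊨) (trans (proj₂ p⊨) (sym β⊨d))))))

pair-B-span-dual : ∀ {d X c β D} m (S : InImmSpan d X) → IsDualImm (c ∷ β) D → suc m ℕ.+ d ≡ sum (c ∷ β) →
  pair (B (suc m) X) D ≡ δℕ (suc m) c * ∑ (λ p → proj₁ p * δ (proj₂ p) β) (terms S)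
pair-B-span-dual {X = X} {c} {β} {D} m S dual degree = begin
    pair (B (suc m) X) D
      ≡⟨ pair-span-dual (span-B m S) dual (sym degree) ⟩
    ∑ (λ p → proj₁ p * δ (proj₂ p) (c ∷ β)) (map (map₂ (suc m ∷_)) (terms S))
      ≡⟨ ∑-map (λ p → proj₁ p * δ (proj₂ p) (c ∷ β)) (map₂ (suc m ∷_)) (terms S) ⟩
    ∑ (λ p → proj₁ p * δ (suc m ∷ proj₂ p) (c ∷ β)) (terms S)
      ≡⟨ ∑-cong (λ p → trans (cong (proj₁ p *_) (δ-∷ (suc m) c (proj₂ p) β))
           (reorder (proj₁ p) (δℕ (suc m) c) (δ (proj₂ p) β))) (terms S) ⟩
    ∑ (λ p → δℕ (suc m) c * (proj₁ p * δ (proj₂ p) β)) (terms S)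
      ≡⟨ sym (∑-distribˡ (δℕ (suc m) c) _ (terms S)) ⟩
    δℕ (suc m) c * ∑ (λ p → proj₁ p * δ (proj₂ p) β) (terms S) ∎
  where
  open ≡-Reasoning
  reorder : ∀ a b c → a * (b * c) ≡ b * (a * c)
  reorder = solve 3 (λ a b c → a :* (b :* c) := b :* (a :* c)) refl

pair-B-perp-dual : ∀ {s r α β Dβ Dsrβ} → IsComp α → sum α ≡ sum β ℕ.+ s →
  IsDualImm β Dβ → IsDualImm (s ℕ.+ suc r ∷ β) Dsrβ → ∀ s′ → s′ ≤ sum α →
  pair (B (suc r ℕ.+ s′) (perp (Fs s′) (imm α))) Dsrβ ≡ δℕ s s′ * pair (perp (Fs s) (imm α)) Dβ
pair-B-perp-dual {s} {r} {α} {β} {Dβ} {Dsrβ} pα n≡ dβ dsrβ s′ s′≤n = begin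
    pair (B (suc r ℕ.+ s′) (X s′)) Dsrβ
      ≡⟨ pair-B-span-dual (r ℕ.+ s′) (S s′ s′≤n) dsrβ degree ⟩
    δℕ (suc (r ℕ.+ s′)) (s ℕ.+ suc r) * coeffβ (S s′ s′≤n)
      ≡⟨ byCases (s′ ℕ.≟ s) ⟩
    δℕ s s′ * pair (X s) Dβ ∎
  where
  open ≡-Reasoning
  open ℕ-Solver using () renaming (solve to solveℕ; _:=_ to _:=ℕ_; _:+_ to _:+ℕ_; con to conℕ)
  X : ℕ → NSym
  X s′ = perp (Fs s′) (imm α)
  S : ∀ s′ → s′ ≤ sum α → InImmSpan (sum α ∸ s′) (X s′)
  S s′ le = immSpan (sum α ∸ s′) (X s′) (perp-OnComps (Fs s′) (imm α))
    (perp-Fs-homogeneousᶜ s′ (imm α) (imm-homogeneousᶜ pα) le)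
  coeffβ : ∀ {d X} → InImmSpan d X → ℚ
  coeffβ S = ∑ (λ p → proj₁ p * δ (proj₂ p) β) (terms S)
  degree : suc (r ℕ.+ s′) ℕ.+ (sum α ∸ s′) ≡ sum (s ℕ.+ suc r ∷ β)
  degree = begin
    suc (r ℕ.+ s′) ℕ.+ (sum α ∸ s′) ≡⟨ cong suc (trans (ℕ.+-assoc r s′ _) (cong (r ℕ.+_) (ℕ.m+[n∸m]≡n s′≤n))) ⟩
    suc (r ℕ.+ sum α)               ≡⟨ cong (λ n → suc (r ℕ.+ n)) n≡ ⟩
    suc (r ℕ.+ (sum β ℕ.+ s))       ≡⟨ solveℕ 3 (λ r b s → conℕ 1 :+ℕ (r :+ℕ (b :+ℕ s)) :=ℕ s :+ℕ (conℕ 1 :+ℕ r) :+ℕ b)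
                                         refl r (sum β) s ⟩
    s ℕ.+ suc r ℕ.+ sum β           ∎
  byCases : Dec (s′ ≡ s) → δℕ (suc (r ℕ.+ s′)) (s ℕ.+ suc r) * coeffβ (S s′ s′≤n) ≡ δℕ s s′ * pair (X s) Dβ
  byCases (yes refl) = begin
      δℕ (suc (r ℕ.+ s)) (s ℕ.+ suc r) * coeffβ (S s s′≤n)
        ≡⟨ cong (_* coeffβ (S s s′≤n)) (δℕ-≡ (trans (cong suc (ℕ.+-comm r s)) (sym (ℕ.+-suc s r)))) ⟩
      1ℚ * coeffβ (S s s′≤n)
        ≡⟨ cong (1ℚ *_) (sym (pair-span-dual (S s s′≤n) dβ (sym (trans (cong (_∸ s) n≡) (ℕ.m+n∸n≡m (sum β) s))))) ⟩
      1ℚ * pair (X s) Dβ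
        ≡⟨ cong (_* pair (X s) Dβ) (sym (δℕ-≡ {s} refl)) ⟩
      δℕ s s * pair (X s) Dβ ∎
  byCases (no s′≢s) = trans (cong (_* coeffβ (S s′ s′≤n)) (δℕ-≢ _ _ differentFirstPart))
    (trans (*-zeroˡ (coeffβ (S s′ s′≤n)))
      (sym (trans (cong (_* pair (X s) Dβ) (δℕ-≢ s s′ (s′≢s ∘ sym))) (*-zeroˡ (pair (X s) Dβ)))))
    where
    differentFirstPart : suc (r ℕ.+ s′) ≢ s ℕ.+ suc r
    differentFirstPart e =
      s′≢s (ℕ.+-cancelˡ-≡ r s′ s (trans (ℕ.suc-injective (trans e (ℕ.+-suc s r))) (ℕ.+-comm s r)))

lemma3p1 : (s r : ℕ) → 0 < r → (α β : Comp) → IsComp α → IsComp β →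
    sum α ≡ sum β ℕ.+ s →
    (Dβ Dsrβ : QSym) → IsDualImm β Dβ → IsDualImm (s ℕ.+ r ∷ β) Dsrβ →
    pair (imm α) (qmul (Fs s) Dβ) ≡ pair (Hmul r (imm α)) Dsrβ
lemma3p1 s (suc r) _ α β pα _ n≡ Dβ Dsrβ dβ dsrβ = begin
    pair (imm α) (qmul (Fs s) Dβ)
      ≡⟨ sym (perp-adjoint (Fs s) (imm α) Dβ (Fs-homogeneous s) (dual-homogeneous dβ)) ⟩
    pair (X s) Dβ
      ≡⟨ sym (∑ℕ-δℕ (suc n) (λ _ → pair (X s) Dβ) (s≤s s≤n)) ⟩
    ∑ℕ (suc n) (λ s′ → δℕ s s′ * pair (X s) Dβ)
      ≡⟨ sym (∑ℕ-cong (suc n) (λ s′ s′<n → pair-B-perp-dual pα n≡ dβ dsrβ s′ (ℕ.≤-pred s′<n))) ⟩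
    ∑ℕ (suc n) (λ s′ → pair (B (suc r ℕ.+ s′) (X s′)) Dsrβ)
      ≡⟨ sym (trans (pair-concatMap (λ s′ → B (suc r ℕ.+ s′) (X s′)) (upTo (suc n)) Dsrβ)
           (∑-upTo (λ s′ → pair (B (suc r ℕ.+ s′) (X s′)) Dsrβ) (suc n))) ⟩
    pair (expansion r (imm-OnComps pα) (imm-homogeneousᶜ pα)) Dsrβ
      ≡⟨ sym (pair-≈ (Hmul≈expansion r (imm-OnComps pα) (imm-homogeneousᶜ pα)) Dsrβ) ⟩
    pair (Hmul (suc r) (imm α)) Dsrβ ∎
  where
  open ≡-Reasoning
  open Hmul-expansion using (expansion; Hmul≈expansion)
  n = sum α
  X : ℕ → NSym
  X s′ = perp (Fs s′) (imm α)
  s≤n : s ≤ n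
  s≤n = subst (s ≤_) (sym n≡) (ℕ.m≤n+m s (sum β))
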